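{- For every nonnegative integer $n$, the number of partitions $\lambda$ of $n$ with $\ell(\lambda)+\mu_2(\lambda)$ even minus the number of partitions $\lambda$ of $n$ with $\ell(\lambda)+\mu_2(\lambda)$ odd equals the number of partitions of $n$ into distinct odd parts.
   Context: For a partition $\lambda$, $\ell(\lambda)$ is its number of parts, and $\mu_2(\lambda)$ (its $2$-measure) is the length of the largest subsequence of parts of $\lambda$ (parts listed in order, with repetition allowed) in which the difference between any two consecutive parts of the subsequence is at least $2$. -}

module Defs where

open import Data.Nat using (ℕ; _+_; _≤_; _<_; _≥_; _>_; _%_)
open import Data.List using (List; length)
open import Data.Nat.ListAction using (sum)
open import Data.List.Relation.Unary.All using (All)
open import Data.List.Relation.Unary.Linked using (Linked)
open import Data.List.Relation.Unary.Unique.Propositional using (Unique)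
open import Data.List.Membership.Propositional using (_∈_)
open import Data.List.Relation.Binary.Sublist.Propositional using (_⊆_)
open import Data.Product using (_×_; ∃)
open import Relation.Binary.PropositionalEquality using (_≡_)
open import Function.Bundles using (_⇔_)

IsPartition : ℕ → List ℕ → Set
IsPartition n λ′ = All (0 <_) λ′ × Linked _≥_ λ′ × sum λ′ ≡ n

ℓ : List ℕ → ℕ
ℓ = length

-- A list in which any two consecutive entries differ by at least 2.
-- (Subsequences of a partition are nonincreasing, so consecutive entries
-- a, b satisfy a ≥ b + 2.)
Gap2 : List ℕ → Set
Gap2 = Linked (λ a b → b + 2 ≤ a)

IsMu2 : List ℕ → ℕ → Set
IsMu2 λ′ m =
  (∃ λ s → s ⊆ λ′ × Gap2 s × length s ≡ m)
  × (∀ s → s ⊆ λ′ → Gap2 s → length s ≤ m)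

SumEven : List ℕ → Set
SumEven λ′ = ∃ λ m → IsMu2 λ′ m × (ℓ λ′ + m) % 2 ≡ 0

SumOdd : List ℕ → Set
SumOdd λ′ = ∃ λ m → IsMu2 λ′ m × (ℓ λ′ + m) % 2 ≡ 1

IsDistinctOddPartition : ℕ → List ℕ → Set
IsDistinctOddPartition n λ′ = All (λ k → k % 2 ≡ 1) λ′ × Linked _>_ λ′ × sum λ′ ≡ n

-- L is a duplicate-free list whose elements are exactly the lists satisfying P;
-- hence length L is the number of such objects.
Enumerates : (List ℕ → Set) → List (List ℕ) → Set
Enumerates P L = Unique L × (∀ x → (x ∈ L) ⇔ P x)

-- Let A m t be the signed series Σ (-1)^ℓ(λ) q^|λ| over the partitions λ with parts ≥ t
-- and 2-measure m, and H m the series (-1)^m Σ q^|λ| over the partitions into m distinct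
-- odd parts. The 2-measure is found greedily (keep the smallest part s, discard all parts
-- s and s + 1, repeat), so splitting off the smallest part gives linear recurrences for
-- A m t in t, while removing the part 1 or not gives (1 - q^(2m+2)) H (m+1) = -q^(2m+1) H m.
-- By induction on m, (-q^t; q)_m A m t and (-q; q)_m q^(m(t-1)) H m satisfy the same
-- recurrence in t, whose solutions vanishing below q^t are unique; at t = 1 this gives
-- A m 1 = H m. So for each m, counting the partitions of n with μ₂ = m with sign
-- (-1)^(ℓ + m) gives the number of partitions of n into m distinct odd parts; summing
-- over m gives the theorem.

module Submission where

open import Defs
open import Data.Nat using (ℕ)
open import Data.Integer using (ℤ; +_; _-_)
open import Data.List using (List; length)
open import Data.Product using (_×_)
open import Relation.Binary.PropositionalEquality using (_≡_)

module PowerSeries where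

  open import Data.Nat as ℕ using (ℕ; zero; suc; _≤_; _<_; _∸_; s≤s)
  import Data.Nat.Properties as ℕ
  open import Data.Nat.Induction using (<-rec)
  open import Data.Integer using (ℤ; 0ℤ; 1ℤ; _+_; -_)
  import Data.Integer.Properties as ℤ
  open import Algebra.Properties.AbelianGroup ℤ.+-0-abelianGroup using (∙-cancelʳ)
  open import Data.Integer.Tactic.RingSolver using (solve-∀)
  open import Function using (_∘_)
  open import Relation.Binary.PropositionalEquality
  import Relation.Binary.Reasoning.Setoid (ℕ →-setoid ℤ) as ≗-Reasoning

  Series : Set
  Series = ℕ → ℤ

  infixl 6 _⊕_
  infixr 7 ⊝_ q^_·_ [1+q^_]_ [1-q^_]_

  _⊕_ : Series → Series → Series
  (X ⊕ Y) n = X n + Y n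

  ⊝_ : Series → Series
  (⊝ X) n = - X n

  𝟙 : Series
  𝟙 zero    = 1ℤ
  𝟙 (suc n) = 0ℤ

  q^_·_ : ℕ → Series → Series
  (q^ zero  · X) n       = X n
  (q^ suc k · X) zero    = 0ℤ
  (q^ suc k · X) (suc n) = (q^ k · X) n

  [1+q^_]_ : ℕ → Series → Series
  [1+q^ k ] X = X ⊕ q^ k · X

  [1-q^_]_ : ℕ → Series → Series
  [1-q^ k ] X = X ⊕ ⊝ q^ k · X

  poch : ℕ → ℕ → Series → Series
  poch t zero    X = X
  poch t (suc m) X = [1+q^ t ] poch (suc t) m X

  ⊕-cong : ∀ {X X′ Y Y′} → X ≗ X′ → Y ≗ Y′ → X ⊕ Y ≗ X′ ⊕ Y′
  ⊕-cong p q n = cong₂ _+_ (p n) (q n)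

  ⊕-congˡ : ∀ X {Y Y′} → Y ≗ Y′ → X ⊕ Y ≗ X ⊕ Y′
  ⊕-congˡ X = ⊕-cong {X} {X} (λ _ → refl)

  ⊝-cong : ∀ {X Y} → X ≗ Y → ⊝ X ≗ ⊝ Y
  ⊝-cong p n = cong -_ (p n)

  shift-≥ : ∀ k X {n} → k ≤ n → (q^ k · X) n ≡ X (n ∸ k)
  shift-≥ zero    X _         = refl
  shift-≥ (suc k) X (s≤s k≤n) = shift-≥ k X k≤n

  shift-< : ∀ k X {n} → n < k → (q^ k · X) n ≡ 0ℤ
  shift-< (suc k) X {zero}  _         = refl
  shift-< (suc k) X {suc n} (s≤s n<k) = shift-< k X n<k

  shift-agree-below : ∀ k {X Y} n → (∀ {j} → j < n → X j ≡ Y j) →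
                      (q^ suc k · X) n ≡ (q^ suc k · Y) n
  shift-agree-below k       zero    _  = refl
  shift-agree-below zero    (suc n) eq = eq ℕ.≤-refl
  shift-agree-below (suc k) (suc n) eq = shift-agree-below k n (eq ∘ ℕ.m≤n⇒m≤1+n)

  shift-+ : ∀ a b X → q^ a · q^ b · X ≗ q^ (a ℕ.+ b) · X
  shift-+ zero    b X n       = refl
  shift-+ (suc a) b X zero    = refl
  shift-+ (suc a) b X (suc n) = shift-+ a b X n

  shift-comm : ∀ a b X → q^ a · q^ b · X ≗ q^ b · q^ a · X
  shift-comm a b X = begin
    q^ a · q^ b · X      ≈⟨ shift-+ a b X ⟩
    q^ (a ℕ.+ b) · X     ≡⟨ cong (q^_· X) (ℕ.+-comm a b) ⟩
    q^ (b ℕ.+ a) · X     ≈⟨ shift-+ b a X ⟨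
    q^ b · q^ a · X      ∎
    where open ≗-Reasoning

  record ShiftLinear (F : Series → Series) : Set where
    field
      cong-≗     : ∀ {X Y} → X ≗ Y → F X ≗ F Y
      ⊕-homo     : ∀ X Y → F (X ⊕ Y) ≗ F X ⊕ F Y
      ⊝-homo     : ∀ X → F (⊝ X) ≗ ⊝ F X
      shift-homo : ∀ k X → F (q^ k · X) ≗ q^ k · F X

  open ShiftLinear

  shift-linear : ∀ k → ShiftLinear (q^ k ·_)
  shift-linear k = record
    { cong-≗     = shift-cong k
    ; ⊕-homo     = shift-⊕ k
    ; ⊝-homo     = shift-⊝ k
    ; shift-homo = λ a X → shift-comm k a X
    }
    where
    shift-cong : ∀ k {X Y} → X ≗ Y → q^ k · X ≗ q^ k · Y
    shift-cong zero    eq n       = eq n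
    shift-cong (suc k) eq zero    = refl
    shift-cong (suc k) eq (suc n) = shift-cong k eq n

    shift-⊕ : ∀ k X Y → q^ k · (X ⊕ Y) ≗ q^ k · X ⊕ q^ k · Y
    shift-⊕ zero    X Y n       = refl
    shift-⊕ (suc k) X Y zero    = refl
    shift-⊕ (suc k) X Y (suc n) = shift-⊕ k X Y n

    shift-⊝ : ∀ k X → q^ k · ⊝ X ≗ ⊝ q^ k · X
    shift-⊝ zero    X n       = refl
    shift-⊝ (suc k) X zero    = refl
    shift-⊝ (suc k) X (suc n) = shift-⊝ k X n

  ∘-linear : ∀ {F G} → ShiftLinear F → ShiftLinear G → ShiftLinear (F ∘ G)
  ∘-linear linF linG = record
    { cong-≗     = λ eq → cong-≗ linF (cong-≗ linG eq)
    ; ⊕-homo     = λ X Y n → trans (cong-≗ linF (⊕-homo linG X Y) n) (⊕-homo linF _ _ n)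
    ; ⊝-homo     = λ X n → trans (cong-≗ linF (⊝-homo linG X) n) (⊝-homo linF _ n)
    ; shift-homo = λ k X n → trans (cong-≗ linF (shift-homo linG k X) n) (shift-homo linF k _ n)
    }

  id⊕-linear : ∀ {F} → ShiftLinear F → ShiftLinear (λ X → X ⊕ F X)
  id⊕-linear {F} lin = record
    { cong-≗     = λ eq → ⊕-cong eq (cong-≗ lin eq)
    ; ⊕-homo     = λ X Y n → trans (cong (λ z → X n + Y n + z) (⊕-homo lin X Y n))
                                   (interchange (X n) (Y n) _ _)
    ; ⊝-homo     = λ X n → trans (cong (λ z → - X n + z) (⊝-homo lin X n))
                                  (sym (ℤ.neg-distrib-+ (X n) _))
    ; shift-homo = λ k X → begin
        q^ k · X ⊕ F (q^ k · X)   ≈⟨ ⊕-congˡ (q^ k · X) (shift-homo lin k X) ⟩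
        q^ k · X ⊕ q^ k · F X     ≈⟨ ⊕-homo (shift-linear k) X (F X) ⟨
        q^ k · (X ⊕ F X)          ∎
    }
    where
    open ≗-Reasoning
    interchange : ∀ a b c d → a + b + (c + d) ≡ a + c + (b + d)
    interchange = solve-∀

  [1+q^]-linear : ∀ k → ShiftLinear ([1+q^ k ]_)
  [1+q^]-linear k = id⊕-linear (shift-linear k)

  ⊝-linear : ShiftLinear ⊝_
  ⊝-linear = record
    { cong-≗     = ⊝-cong
    ; ⊕-homo     = λ X Y n → ℤ.neg-distrib-+ (X n) (Y n)
    ; ⊝-homo     = λ _ _ → refl
    ; shift-homo = λ k X n → sym (⊝-homo (shift-linear k) X n)
    }

  [1-q^]-linear : ∀ k → ShiftLinear ([1-q^ k ]_)
  [1-q^]-linear k = id⊕-linear (∘-linear ⊝-linear (shift-linear k))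

  poch-linear : ∀ t m → ShiftLinear (poch t m)
  poch-linear t zero    = record
    { cong-≗     = λ eq → eq
    ; ⊕-homo     = λ _ _ _ → refl
    ; ⊝-homo     = λ _ _ → refl
    ; shift-homo = λ _ _ _ → refl
    }
  poch-linear t (suc m) = ∘-linear ([1+q^]-linear t) (poch-linear (suc t) m)

  linear-[1+q^] : ∀ {F} → ShiftLinear F → ∀ k X → F ([1+q^ k ] X) ≗ [1+q^ k ] F X
  linear-[1+q^] {F} lin k X = begin
    F (X ⊕ q^ k · X)     ≈⟨ ⊕-homo lin X _ ⟩
    F X ⊕ F (q^ k · X)   ≈⟨ ⊕-congˡ (F X) (shift-homo lin k X) ⟩
    F X ⊕ q^ k · F X     ∎
    where open ≗-Reasoning

  linear-[1-q^] : ∀ {F} → ShiftLinear F → ∀ k X → F ([1-q^ k ] X) ≗ [1-q^ k ] F X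
  linear-[1-q^] {F} lin k X = begin
    F (X ⊕ ⊝ q^ k · X)     ≈⟨ ⊕-homo lin X _ ⟩
    F X ⊕ F (⊝ q^ k · X)   ≈⟨ ⊕-congˡ (F X) (⊝-homo lin _) ⟩
    F X ⊕ ⊝ F (q^ k · X)   ≈⟨ ⊕-congˡ (F X) (⊝-cong (shift-homo lin k X)) ⟩
    F X ⊕ ⊝ q^ k · F X     ∎
    where open ≗-Reasoning

  poch-suc : ∀ t m X → poch t (suc m) X ≗ [1+q^ t ℕ.+ m ] poch t m X
  poch-suc t zero    X n = cong (λ k → ([1+q^ k ] X) n) (sym (ℕ.+-identityʳ t))
  poch-suc t (suc m) X = begin
    [1+q^ t ] poch (suc t) (suc m) X
      ≈⟨ cong-≗ ([1+q^]-linear t) (poch-suc (suc t) m X) ⟩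
    [1+q^ t ] [1+q^ suc t ℕ.+ m ] poch (suc t) m X
      ≈⟨ linear-[1+q^] ([1+q^]-linear t) (suc t ℕ.+ m) (poch (suc t) m X) ⟩
    [1+q^ suc t ℕ.+ m ] poch t (suc m) X
      ≡⟨ cong ([1+q^_] poch t (suc m) X) (sym (ℕ.+-suc t m)) ⟩
    [1+q^ t ℕ.+ suc m ] poch t (suc m) X ∎
    where open ≗-Reasoning

  [1-q^]-[1+q^] : ∀ k X → [1-q^ k ] [1+q^ k ] X ≗ [1-q^ k ℕ.+ k ] X
  [1-q^]-[1+q^] k X n = begin
    X n + (q^ k · X) n + - (q^ k · (X ⊕ q^ k · X)) n
      ≡⟨ cong (λ z → X n + (q^ k · X) n + - z) (⊕-homo (shift-linear k) X _ n) ⟩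
    X n + (q^ k · X) n + - ((q^ k · X) n + (q^ k · q^ k · X) n)
      ≡⟨ cancel (X n) _ _ ⟩
    X n + - (q^ k · q^ k · X) n
      ≡⟨ cong (λ z → X n + - z) (shift-+ k k X n) ⟩
    X n + - (q^ k ℕ.+ k · X) n ∎
    where
    open ≡-Reasoning
    cancel : ∀ a b c → a + b + - (b + c) ≡ a + - c
    cancel = solve-∀

  infix 4 q^_∣_
  q^_∣_ : ℕ → Series → Set
  q^ t ∣ X = ∀ {j} → j < t → X j ≡ 0ℤ

  ∣-weaken : ∀ {a b X} → a ≤ b → q^ b ∣ X → q^ a ∣ X
  ∣-weaken a≤b div j<a = div (ℕ.<-≤-trans j<a a≤b)

  ∣-shift : ∀ k {t X} → q^ t ∣ X → q^ k ℕ.+ t ∣ q^ k · X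
  ∣-shift zero    div                           = div
  ∣-shift (suc k) div {zero}  _                 = refl
  ∣-shift (suc k) div {suc j} (s≤s j<k+t)       = ∣-shift k div j<k+t

  ∣-[1+q^] : ∀ k {t X} → q^ t ∣ X → q^ t ∣ [1+q^ k ] X
  ∣-[1+q^] k {t} div j<t = cong₂ _+_ (div j<t) (∣-weaken (ℕ.m≤n+m t k) (∣-shift k div) j<t)

  ∣-poch : ∀ u m {t X} → q^ t ∣ X → q^ t ∣ poch u m X
  ∣-poch u zero    div = div
  ∣-poch u (suc m) div = ∣-[1+q^] u (∣-poch (suc u) m div)

  -- Coefficient n of [1 + q^(k+1)] X is X n plus a coefficient of X below n.
  [1+q^suc]-injective : ∀ k {X Y} → [1+q^ suc k ] X ≗ [1+q^ suc k ] Y → X ≗ Y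
  [1+q^suc]-injective k {X} {Y} eq = <-rec (λ n → X n ≡ Y n) step
    where
    step : ∀ n → (∀ {j} → j < n → X j ≡ Y j) → X n ≡ Y n
    step n ih = ∙-cancelʳ _ (X n) (Y n)
      (trans (eq n) (cong (λ z → Y n + z) (sym (shift-agree-below k n ih))))

  poch-injective : ∀ t m {X Y} → poch (suc t) m X ≗ poch (suc t) m Y → X ≗ Y
  poch-injective t zero    eq = eq
  poch-injective t (suc m) eq = poch-injective (suc t) m ([1+q^suc]-injective t eq)

  -- Coefficient n of Y t is determined by the recurrence from coefficient n of Y (t + 1) and
  -- lower coefficients; for t ≥ n it vanishes. Induct on n, and for fixed n downwards in t.
  recurrence-unique : ∀ c (W : ℕ → Series) {Y Z : ℕ → Series} →
    (∀ t → q^ suc t ∣ Y t) → (∀ t → q^ suc t ∣ Z t) →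
    (∀ t → [1+q^ suc t ℕ.+ c ] Y t ≗ [1+q^ suc t ] Y (suc t) ⊕ W t) →
    (∀ t → [1+q^ suc t ℕ.+ c ] Z t ≗ [1+q^ suc t ] Z (suc t) ⊕ W t) →
    ∀ t → Y t ≗ Z t
  recurrence-unique c W {Y} {Z} Y∣ Z∣ Y-rec Z-rec t n = <-rec P step n t
    where
    P : ℕ → Set
    P n = ∀ t → Y t n ≡ Z t n

    step : ∀ n → (∀ {j} → j < n → P j) → P n
    step n ih t = descend n t (ℕ.m≤m+n n t)
      where
      descend : ∀ d t → n ≤ d ℕ.+ t → Y t n ≡ Z t n
      descend zero    t n≤t = trans (Y∣ t (s≤s n≤t)) (sym (Z∣ t (s≤s n≤t)))
      descend (suc d) t n≤d+t = ∙-cancelʳ ((q^ suc t ℕ.+ c · Y t) n) (Y t n) (Z t n) (begin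
        Y t n + (q^ suc t ℕ.+ c · Y t) n
          ≡⟨ Y-rec t n ⟩
        ([1+q^ suc t ] Y (suc t) ⊕ W t) n
          ≡⟨ cong₂ (λ a b → a + b + W t n) next (shift-agree-below t n (λ j<n → ih j<n (suc t))) ⟩
        ([1+q^ suc t ] Z (suc t) ⊕ W t) n
          ≡⟨ Z-rec t n ⟨
        Z t n + (q^ suc t ℕ.+ c · Z t) n
          ≡⟨ cong (λ z → Z t n + z) (shift-agree-below (t ℕ.+ c) n (λ j<n → sym (ih j<n t))) ⟩
        Z t n + (q^ suc t ℕ.+ c · Y t) n ∎)
        where
        open ≡-Reasoning
        next : Y (suc t) n ≡ Z (suc t) n
        next = descend d (suc t) (subst (n ≤_) (sym (ℕ.+-suc d t)) n≤d+t)

module SeriesIdentity where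

  open import Data.Nat as ℕ using (ℕ; zero; suc; _+_; _*_; _≤_; s≤s)
  import Data.Nat.Properties as ℕ
  open import Data.Nat.Tactic.RingSolver using (solve-∀)
  open import Data.Integer using (ℤ) renaming (_+_ to _+ᶻ_; -_ to -ᶻ_)
  open import Data.Integer.Tactic.RingSolver renaming (solve-∀ to solveℤ-∀)
  open import Relation.Binary.PropositionalEquality
  open import Relation.Binary.Reasoning.Setoid (ℕ →-setoid ℤ)
  open PowerSeries
  open ShiftLinear

  -- A and H as in the header; Ea m s and Eb m s are the series of the Run m s and Skip m s
  -- lists of GreedySelection.
  module _
    (A Ea Eb : ℕ → ℕ → Series) (H : ℕ → Series)
    (A-zero  : ∀ t → A 0 t ≗ 𝟙)
    (A-split : ∀ m t → A (suc m) t ≗ A (suc m) (suc t) ⊕ Ea m t)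
    (Ea-rec  : ∀ m s → [1+q^ suc s ] Ea m (suc s) ≗ ⊝ q^ suc s · Eb m (suc s))
    (Eb-rec  : ∀ m s → [1+q^ suc (suc s) ] Eb m (suc s) ≗ A m (suc (suc (suc s))))
    (A-∣     : ∀ m t → q^ t ∣ A (suc m) t)
    (H-zero  : H 0 ≗ 𝟙)
    (H-rec   : ∀ m → [1-q^ suc m + suc m ] H (suc m) ≗ ⊝ q^ suc m + m · H m)
    (H-∣     : ∀ m → q^ 1 ∣ H (suc m))
    where

    X : ℕ → ℕ → Series
    X m t = poch t m (A m t)

    R : ℕ → ℕ → Series
    R m t = poch 1 m (q^ m * t · H m)

    poch-Ea : ∀ m t → poch (suc t) (suc (suc m)) (Ea m (suc t)) ≗ ⊝ q^ suc t · X m (suc (suc (suc t)))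
    poch-Ea m t = begin
      [1+q^ τ ] [1+q^ suc τ ] P E
        ≈⟨ cong-≗ ([1+q^]-linear τ) (linear-[1+q^] P-lin (suc τ) E) ⟨
      [1+q^ τ ] P ([1+q^ suc τ ] E)
        ≈⟨ linear-[1+q^] P-lin τ _ ⟨
      P ([1+q^ τ ] [1+q^ suc τ ] E)
        ≈⟨ cong-≗ P-lin (linear-[1+q^] ([1+q^]-linear (suc τ)) τ E) ⟨
      P ([1+q^ suc τ ] [1+q^ τ ] E)
        ≈⟨ cong-≗ P-lin (cong-≗ ([1+q^]-linear (suc τ)) (Ea-rec m t)) ⟩
      P ([1+q^ suc τ ] ⊝ q^ τ · Eb m τ)
        ≈⟨ cong-≗ P-lin (⊝-homo ([1+q^]-linear (suc τ)) (q^ τ · Eb m τ)) ⟩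
      P (⊝ [1+q^ suc τ ] q^ τ · Eb m τ)
        ≈⟨ cong-≗ P-lin (⊝-cong (shift-homo ([1+q^]-linear (suc τ)) τ _)) ⟩
      P (⊝ q^ τ · [1+q^ suc τ ] Eb m τ)
        ≈⟨ cong-≗ P-lin (⊝-cong (cong-≗ (shift-linear τ) (Eb-rec m t))) ⟩
      P (⊝ q^ τ · A m (suc (suc τ)))
        ≈⟨ ⊝-homo P-lin _ ⟩
      ⊝ P (q^ τ · A m (suc (suc τ)))
        ≈⟨ ⊝-cong (shift-homo P-lin τ _) ⟩
      ⊝ q^ τ · X m (suc (suc τ)) ∎
      where
      τ = suc t
      E = Ea m τ
      P = poch (suc (suc τ)) m
      P-lin = poch-linear (suc (suc τ)) m

    X-rec : ∀ m t → [1+q^ suc t + suc m ] X (suc m) (suc t)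
                  ≗ [1+q^ suc t ] X (suc m) (suc (suc t)) ⊕ ⊝ q^ suc t · X m (suc (suc (suc t)))
    X-rec m t = begin
      [1+q^ τ + suc m ] P (A (suc m) τ)
        ≈⟨ poch-suc τ (suc m) _ ⟨
      P′ (A (suc m) τ)
        ≈⟨ cong-≗ P′-lin (A-split m τ) ⟩
      P′ (A (suc m) (suc τ) ⊕ Ea m τ)
        ≈⟨ ⊕-homo P′-lin _ _ ⟩
      [1+q^ τ ] X (suc m) (suc τ) ⊕ P′ (Ea m τ)
        ≈⟨ ⊕-congˡ ([1+q^ τ ] X (suc m) (suc τ)) (poch-Ea m t) ⟩
      [1+q^ τ ] X (suc m) (suc τ) ⊕ ⊝ q^ τ · X m (suc (suc τ)) ∎
      where
      τ = suc t
      P = poch τ (suc m)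
      P′ = poch τ (suc (suc m))
      P′-lin = poch-linear τ (suc (suc m))

    R-shift : ∀ m t → R (suc m) (suc t) ≗ q^ suc m · R (suc m) t
    R-shift m t = begin
      P (q^ suc m * suc t · H (suc m))
        ≡⟨ cong (λ k → P (q^ k · H (suc m))) (ℕ.*-suc (suc m) t) ⟩
      P (q^ suc m + suc m * t · H (suc m))
        ≈⟨ cong-≗ P-lin (shift-+ (suc m) _ _) ⟨
      P (q^ suc m · q^ suc m * t · H (suc m))
        ≈⟨ shift-homo P-lin (suc m) _ ⟩
      q^ suc m · R (suc m) t ∎
      where
      P = poch 1 (suc m)
      P-lin = poch-linear 1 (suc m)

    shifted-H-rec : ∀ m t → [1-q^ suc m + suc m ] q^ suc m * t · H (suc m)
                            ≗ ⊝ q^ suc t · q^ m * suc (suc t) · H m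
    shifted-H-rec m t = begin
      [1-q^ suc m + suc m ] q^ c · H (suc m)
        ≈⟨ linear-[1-q^] (shift-linear c) (suc m + suc m) (H (suc m)) ⟨
      q^ c · [1-q^ suc m + suc m ] H (suc m)
        ≈⟨ cong-≗ (shift-linear c) (H-rec m) ⟩
      q^ c · ⊝ q^ suc m + m · H m
        ≈⟨ ⊝-homo (shift-linear c) _ ⟩
      ⊝ q^ c · q^ suc m + m · H m
        ≈⟨ ⊝-cong (shift-+ c _ _) ⟩
      ⊝ q^ c + (suc m + m) · H m
        ≡⟨ cong (λ k → ⊝ q^ k · H m) (exponents m t) ⟩
      ⊝ q^ suc t + m * suc (suc t) · H m
        ≈⟨ ⊝-cong (shift-+ (suc t) _ _) ⟨
      ⊝ q^ suc t · q^ m * suc (suc t) · H m ∎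
      where
      c = suc m * t
      exponents : ∀ m t → suc m * t + (suc m + m) ≡ suc t + m * suc (suc t)
      exponents = solve-∀

    R-step : ∀ m t → [1-q^ suc m ] R (suc m) t ≗ ⊝ q^ suc t · R m (suc (suc t))
    R-step m t = begin
      [1-q^ suc m ] poch 1 (suc m) G                     ≈⟨ cong-≗ ([1-q^]-linear (suc m)) (poch-suc 1 m G) ⟩
      [1-q^ suc m ] [1+q^ suc m ] P G                    ≈⟨ [1-q^]-[1+q^] (suc m) (P G) ⟩
      [1-q^ suc m + suc m ] P G                          ≈⟨ linear-[1-q^] P-lin (suc m + suc m) G ⟨
      P ([1-q^ suc m + suc m ] G)                        ≈⟨ cong-≗ P-lin (shifted-H-rec m t) ⟩
      P (⊝ q^ suc t · q^ m * suc (suc t) · H m)          ≈⟨ ⊝-homo P-lin _ ⟩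
      ⊝ P (q^ suc t · q^ m * suc (suc t) · H m)          ≈⟨ ⊝-cong (shift-homo P-lin (suc t) _) ⟩
      ⊝ q^ suc t · R m (suc (suc t))                     ∎
      where
      G = q^ suc m * t · H (suc m)
      P = poch 1 m
      P-lin = poch-linear 1 m

    R-rec : ∀ m t → [1+q^ suc t + suc m ] R (suc m) t
                  ≗ [1+q^ suc t ] R (suc m) (suc t) ⊕ ⊝ q^ suc t · R m (suc (suc t))
    R-rec m t n =
      trans (rearrange r a b) (sym (cong₂ _+ᶻ_ (cong₂ _+ᶻ_ (R-shift m t n) shifted) (sym (R-step m t n))))
      where
      R′ = R (suc m) t
      r = R′ n
      a = (q^ suc t + suc m · R′) n
      b = (q^ suc m · R′) n
      shifted : (q^ suc t · R (suc m) (suc t)) n ≡ a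
      shifted = trans (cong-≗ (shift-linear (suc t)) (R-shift m t) n) (shift-+ (suc t) (suc m) R′ n)
      rearrange : ∀ r a b → r +ᶻ a ≡ b +ᶻ a +ᶻ (r +ᶻ -ᶻ b)
      rearrange = solveℤ-∀

    X≗R : ∀ m t → X m (suc t) ≗ R m t
    X≗R zero    t n = trans (A-zero (suc t) n) (sym (H-zero n))
    X≗R (suc m) = recurrence-unique (suc m) W Y∣ Z∣ (X-rec m) Z-rec
      where
      W : ℕ → Series
      W t = ⊝ q^ suc t · X m (suc (suc (suc t)))

      Y∣ : ∀ t → q^ suc t ∣ X (suc m) (suc t)
      Y∣ t = ∣-poch (suc t) (suc m) (A-∣ m (suc t))

      Z∣ : ∀ t → q^ suc t ∣ R (suc m) t
      Z∣ t = ∣-poch 1 (suc m) (∣-weaken t+1≤ (∣-shift (suc m * t) (H-∣ m)))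
        where
        t+1≤ : suc t ≤ suc m * t + 1
        t+1≤ = subst (suc t ≤_) (ℕ.+-comm 1 (suc m * t)) (s≤s (ℕ.m≤m+n t (m * t)))

      Z-rec : ∀ t → [1+q^ suc t + suc m ] R (suc m) t ≗ [1+q^ suc t ] R (suc m) (suc t) ⊕ W t
      Z-rec t = begin
        [1+q^ suc t + suc m ] R (suc m) t
          ≈⟨ R-rec m t ⟩
        [1+q^ suc t ] R (suc m) (suc t) ⊕ ⊝ q^ suc t · R m (suc (suc t))
          ≈⟨ ⊕-congˡ ([1+q^ suc t ] R (suc m) (suc t))
                     (⊝-cong (cong-≗ (shift-linear (suc t)) (X≗R m (suc (suc t))))) ⟨
        [1+q^ suc t ] R (suc m) (suc t) ⊕ W t ∎

    A≗H : ∀ m → A m 1 ≗ H m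
    A≗H m = poch-injective 0 m λ n →
      trans (X≗R m 0 n) (cong (λ k → poch 1 m (q^ k · H m) n) (ℕ.*-zeroʳ m))

module Lists where

  open import Data.Nat as ℕ using (ℕ; zero; suc; _+_; _∸_; _≤_; _<_; _≤?_; z≤n; s≤s)
  import Data.Nat.Properties as ℕ
  open import Data.Nat.ListAction using (sum)
  open import Data.Nat.ListAction.Properties using (sum-↭)
  open import Data.List using (List; []; _∷_; map; concatMap; length; reverse; reverseAcc)
  open import Data.List.Membership.Propositional using (_∈_; find; lose)
  open import Data.List.Membership.Propositional.Properties using (∈-concatMap⁺; ∈-concatMap⁻; ∈-map⁺)
  open import Data.List.Membership.Propositional.Properties.WithK using (unique∧set⇒bag)
  open import Data.List.Relation.Binary.BagAndSetEquality using (∼bag⇒↭)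
  open import Data.List.Relation.Binary.Permutation.Propositional using (↭-sym)
  open import Data.List.Relation.Binary.Permutation.Propositional.Properties using (↭-length; ↭-reverse; All-resp-↭)
  open import Data.List.Relation.Unary.Any using (here; there)
  open import Data.List.Relation.Unary.All as All using (All; []; _∷_)
  import Data.List.Relation.Unary.All.Properties as All
  import Data.List.Relation.Unary.AllPairs as AllPairs
  import Data.List.Relation.Unary.AllPairs.Properties as AllPairs
  open import Data.List.Relation.Unary.Linked using (Linked; []; [-]; _∷_)
  open import Data.List.Relation.Unary.Linked.Properties using (Linked⇒AllPairs)
  open import Data.List.Relation.Unary.Unique.Propositional using (Unique)
  import Data.List.Relation.Unary.Unique.Propositional.Properties as Unique
  open import Data.Product using (∃; _×_; _,_; proj₁)
  open import Data.Empty using (⊥-elim)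
  open import Function using (_⇔_; flip)
  import Function.Properties.Equivalence as ⇔
  open import Relation.Binary.Definitions using (Transitive)
  open import Relation.Binary.PropositionalEquality
  open import Relation.Nullary using (Dec; yes; no)

  private variable
    A : Set

  length-≡ : ∀ {xs ys : List A} → Unique xs → Unique ys → (∀ {z} → (z ∈ xs) ⇔ (z ∈ ys)) →
             length xs ≡ length ys
  length-≡ xs! ys! same = ↭-length (∼bag⇒↭ (unique∧set⇒bag xs! ys! same))

  when : {P : Set} → Dec P → List A → List A
  when (yes _) xs = xs
  when (no _)  _  = []

  ∈-when⁺ : ∀ {P : Set} (d : Dec P) {x} {xs : List A} → P → x ∈ xs → x ∈ when d xs
  ∈-when⁺ (yes _) _ x∈ = x∈
  ∈-when⁺ (no ¬p) p _  = ⊥-elim (¬p p)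

  ∈-when⁻ : ∀ {P : Set} (d : Dec P) {x} {xs : List A} → x ∈ when d xs → P × x ∈ xs
  ∈-when⁻ (yes p) x∈ = p , x∈

  when-unique : ∀ {P : Set} (d : Dec P) {xs : List A} → Unique xs → Unique (when d xs)
  when-unique (yes _) xs! = xs!
  when-unique (no _)  _   = AllPairs.[]

  ∈-guarded-map : ∀ {c q} (f : List ℕ → List ℕ) (L : ℕ → List (List ℕ)) → sum (f q) ≡ c + sum q →
                  q ∈ L (sum q) → f q ∈ when (c ≤? sum (f q)) (map f (L (sum (f q) ∸ c)))
  ∈-guarded-map {c} {q} f L sum≡ q∈ = ∈-when⁺ (c ≤? _) (subst (c ≤_) (sym sum≡) (ℕ.m≤m+n c (sum q)))
    (∈-map⁺ f (subst (λ r → q ∈ L r) (sym (trans (cong (_∸ c) sum≡) (ℕ.m+n∸m≡n c (sum q)))) q∈))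

  n≤1+k⇒n∸1+s≤k : ∀ {n k} s → n ≤ suc k → n ∸ suc s ≤ k
  n≤1+k⇒n∸1+s≤k {zero}  s _         = z≤n
  n≤1+k⇒n∸1+s≤k {suc n} s (s≤s n≤k) = ℕ.≤-trans (ℕ.m∸n≤m n s) n≤k

  range : ℕ → ℕ → List ℕ
  range t zero    = []
  range t (suc k) = t ∷ range (suc t) k

  ∈-range⁻ : ∀ t k {s} → s ∈ range t k → t ≤ s × s < t + k
  ∈-range⁻ t (suc k) (here refl) = ℕ.≤-refl , subst (t <_) (sym (ℕ.+-suc t k)) (s≤s (ℕ.m≤m+n t k))
  ∈-range⁻ t (suc k) {s} (there s∈) with ∈-range⁻ (suc t) k s∈
  ... | t<s , s<t+1+k = ℕ.<⇒≤ t<s , subst (s <_) (sym (ℕ.+-suc t k)) s<t+1+k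

  ∈-range⁺ : ∀ t k {s} → t ≤ s → s < t + k → s ∈ range t k
  ∈-range⁺ t zero    t≤s s<t+0 = ⊥-elim (ℕ.<⇒≱ s<t+0 (subst (_≤ _) (sym (ℕ.+-identityʳ t)) t≤s))
  ∈-range⁺ t (suc k) {s} t≤s s<t+1+k with t ℕ.≟ s
  ... | yes refl = here refl
  ... | no t≢s   = there (∈-range⁺ (suc t) k (ℕ.≤∧≢⇒< t≤s t≢s) (subst (s <_) (ℕ.+-suc t k) s<t+1+k))

  range-unique : ∀ t k → Unique (range t k)
  range-unique t zero    = AllPairs.[]
  range-unique t (suc k) =
    All.tabulate (λ s∈ → ℕ.<⇒≢ (proj₁ (∈-range⁻ (suc t) k s∈))) AllPairs.∷ range-unique (suc t) k

  ∈-concatMap-range⁻ : ∀ (f : ℕ → List A) t k {x} → x ∈ concatMap f (range t k) →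
                       ∃ λ s → t ≤ s × s < t + k × x ∈ f s
  ∈-concatMap-range⁻ f t k x∈ with find (∈-concatMap⁻ f x∈)
  ... | s , s∈ , x∈fs with ∈-range⁻ t k s∈
  ... | t≤s , s<t+k = s , t≤s , s<t+k , x∈fs

  ∈-concatMap-range⁺ : ∀ (f : ℕ → List A) t k {s x} → t ≤ s → s < t + k → x ∈ f s →
                       x ∈ concatMap f (range t k)
  ∈-concatMap-range⁺ f t k t≤s s<t+k x∈fs = ∈-concatMap⁺ f (lose (∈-range⁺ t k t≤s s<t+k) x∈fs)

  concatMap-unique : ∀ (f : ℕ → List A) {xs} → Unique xs → (∀ s → Unique (f s)) →
                     (∀ {s s′ x} → x ∈ f s → x ∈ f s′ → s ≡ s′) → Unique (concatMap f xs)
  concatMap-unique f xs! f! fibres = Unique.concat⁺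
    (All.map⁺ (All.tabulate (λ {s} _ → f! s)))
    (AllPairs.map⁺ (AllPairs.map (λ s≢s′ {_} (x∈fs , x∈fs′) → s≢s′ (fibres x∈fs x∈fs′)) xs!))

  Linked-∷ : ∀ {A : Set} {R : A → A → Set} {x xs} → All (R x) xs → Linked R xs → Linked R (x ∷ xs)
  Linked-∷ []      []  = [-]
  Linked-∷ (r ∷ _) rs  = r ∷ rs

  Linked⇒All-head : ∀ {A : Set} {R : A → A → Set} → Transitive R →
                    ∀ {x xs} → Linked R (x ∷ xs) → All (R x) xs
  Linked⇒All-head R-trans rs with Linked⇒AllPairs R-trans rs
  ... | head AllPairs.∷ _ = head

  Linked-reverse : ∀ {A : Set} {R : A → A → Set} {xs} → Linked R xs → Linked (flip R) (reverse xs)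
  Linked-reverse {R = R} []   = []
  Linked-reverse {R = R} {x ∷ xs} rs = go rs [-]
    where
    go : ∀ {x xs acc} → Linked R (x ∷ xs) → Linked (flip R) (x ∷ acc) →
         Linked (flip R) (reverseAcc (x ∷ acc) xs)
    go [-]      acc = acc
    go (r ∷ rs) acc = go rs (r ∷ acc)

  All-reverse : ∀ {P : ℕ → Set} {p} → All P p → All P (reverse p)
  All-reverse {p = p} = All-resp-↭ (↭-sym (↭-reverse p))

  sum-reverse : ∀ p → sum (reverse p) ≡ sum p
  sum-reverse p = sum-↭ (↭-reverse p)

  length≤sum : ∀ {p} → All (0 <_) p → length p ≤ sum p
  length≤sum All.[]         = z≤n
  length≤sum (0<x All.∷ 0<p) = ℕ.+-mono-≤ 0<x (length≤sum 0<p)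

  enumerations-length : ∀ {P L L′} → Enumerates P L → Enumerates P L′ → length L ≡ length L′
  enumerations-length (L! , L⇔P) (L′! , L′⇔P) =
    length-≡ L! L′! (λ {x} → ⇔.trans (L⇔P x) (⇔.sym (L′⇔P x)))

module SignedSums where

  open import Data.Nat as ℕ using (ℕ; zero; suc; _+_; _∸_; _≤_; _%_)
  import Data.Nat.Properties as ℕ
  open import Data.Integer using (ℤ; +_; 0ℤ; 1ℤ; -_) renaming (_+_ to _+ᶻ_)
  import Data.Integer.Properties as ℤ
  open import Data.List using (List; []; _∷_; _++_; map; length)
  open import Data.List.Relation.Unary.All using (All; []; _∷_)
  open import Relation.Binary.PropositionalEquality
  open import Relation.Nullary using (Dec; yes; no)
  open PowerSeries using (Series; q^_·_; shift-≥; shift-<)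
  open Lists using (when)

  private variable
    A B : Set

  ±[_]_ : ℕ → ℤ → ℤ
  ±[ zero  ] z = z
  ±[ suc k ] z = - ±[ k ] z

  ±-0 : ∀ k → ±[ k ] 0ℤ ≡ 0ℤ
  ±-0 zero    = refl
  ±-0 (suc k) = cong -_ (±-0 k)

  ±-+ : ∀ k a b → ±[ k ] (a +ᶻ b) ≡ ±[ k ] a +ᶻ ±[ k ] b
  ±-+ zero    a b = refl
  ±-+ (suc k) a b = trans (cong -_ (±-+ k a b)) (ℤ.neg-distrib-+ (±[ k ] a) (±[ k ] b))

  ±-± : ∀ j k z → ±[ j ] ±[ k ] z ≡ ±[ j + k ] z
  ±-± zero    k z = refl
  ±-± (suc j) k z = cong -_ (±-± j k z)

  Σ± : List (List A) → ℤ
  Σ± []       = 0ℤ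
  Σ± (p ∷ ps) = ±[ length p ] 1ℤ +ᶻ Σ± ps

  Σ±-++ : ∀ (ps qs : List (List A)) → Σ± (ps ++ qs) ≡ Σ± ps +ᶻ Σ± qs
  Σ±-++ []       qs = sym (ℤ.+-identityˡ (Σ± qs))
  Σ±-++ (p ∷ ps) qs =
    trans (cong (±[ length p ] 1ℤ +ᶻ_) (Σ±-++ ps qs)) (sym (ℤ.+-assoc (±[ length p ] 1ℤ) (Σ± ps) (Σ± qs)))

  Σ±-map : ∀ (f : List A → List B) j → (∀ p → length (f p) ≡ j + length p) →
           ∀ ps → Σ± (map f ps) ≡ ±[ j ] Σ± ps
  Σ±-map f j len []       = sym (±-0 j)
  Σ±-map f j len (p ∷ ps) = begin
    ±[ length (f p) ] 1ℤ +ᶻ Σ± (map f ps)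
      ≡⟨ cong₂ (λ k z → ±[ k ] 1ℤ +ᶻ z) (len p) (Σ±-map f j len ps) ⟩
    ±[ j + length p ] 1ℤ +ᶻ ±[ j ] Σ± ps
      ≡⟨ cong (_+ᶻ ±[ j ] Σ± ps) (±-± j (length p) 1ℤ) ⟨
    ±[ j ] ±[ length p ] 1ℤ +ᶻ ±[ j ] Σ± ps
      ≡⟨ ±-+ j _ (Σ± ps) ⟨
    ±[ j ] Σ± (p ∷ ps) ∎
    where open ≡-Reasoning

  Σ±-guarded : ∀ {k n} (d : Dec (k ≤ n)) (f : List ℕ → List ℕ) j →
               (∀ p → length (f p) ≡ j + length p) → ∀ L (X : Series) →
               (k ≤ n → Σ± L ≡ X (n ∸ k)) → Σ± (when d (map f L)) ≡ ±[ j ] (q^ k · X) n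
  Σ±-guarded {k} (yes k≤n) f j len L X Σ±L≡ =
    trans (Σ±-map f j len L) (cong ±[ j ]_ (trans (Σ±L≡ k≤n) (sym (shift-≥ k X k≤n))))
  Σ±-guarded {k} (no k≰n)  f j len L X _ =
    sym (trans (cong ±[ j ]_ (shift-< k X (ℕ.≰⇒> k≰n))) (±-0 j))

  ±-mod-2 : ∀ k z → ±[ k ] z ≡ ±[ k % 2 ] z
  ±-mod-2 zero          z = refl
  ±-mod-2 (suc zero)    z = refl
  ±-mod-2 (suc (suc k)) z = trans (ℤ.neg-involutive (±[ k ] z)) (±-mod-2 k z)

  ±-involutive : ∀ k z → ±[ k ] ±[ k ] z ≡ z
  ±-involutive zero    z = refl
  ±-involutive (suc k) z = trans (cong -_ (±-neg k (±[ k ] z))) (trans (ℤ.neg-involutive _) (±-involutive k z))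
    where
    ±-neg : ∀ k z → ±[ k ] (- z) ≡ - ±[ k ] z
    ±-neg zero    z = refl
    ±-neg (suc k) z = cong -_ (±-neg k z)

  Σ±-uniform : ∀ m (L : List (List ℕ)) → All (λ p → length p ≡ m) L → Σ± L ≡ ±[ m ] (+ length L)
  Σ±-uniform m []      _            = sym (±-0 m)
  Σ±-uniform m (p ∷ L) (refl All.∷ lengths) = begin
    ±[ m ] 1ℤ +ᶻ Σ± L                  ≡⟨ cong (±[ m ] 1ℤ +ᶻ_) (Σ±-uniform m L lengths) ⟩
    ±[ m ] 1ℤ +ᶻ ±[ m ] (+ length L)   ≡⟨ ±-+ m 1ℤ (+ length L) ⟨
    ±[ m ] (+ suc (length L))          ∎
    where open ≡-Reasoning

module GreedySelection where

  open import Data.Nat as ℕ using (ℕ; suc; _+_; _≤_; _≰_; _<_; z≤n; s≤s)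
  import Data.Nat.Properties as ℕ
  open import Data.List using (List; []; _∷_; length; reverse)
  import Data.List.Properties as List
  open import Data.List.Relation.Unary.All as All using (All; []; _∷_)
  open import Data.List.Relation.Unary.Linked as Linked using (Linked; []; _∷_)
  open import Data.List.Relation.Binary.Sublist.Propositional using (_⊆_; []; _∷_; _∷ʳ_)
  open import Data.List.Relation.Binary.Sublist.Propositional.Properties using (∷ˡ⁻; All-resp-⊆; reverse⁺)
  open import Data.Product using (∃; _×_; _,_; proj₂; map₂)
  open import Data.Empty using (⊥-elim)
  open import Relation.Binary.Definitions using (Transitive)
  open import Relation.Binary.PropositionalEquality
  open import Relation.Nullary using (Dec; yes; no)
  open Lists using (Linked-∷; Linked⇒All-head; Linked-reverse)

  -- Greedy m t p: p is nondecreasing with parts ≥ t, and the greedy choice (keep the smallest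
  -- part s, discard all parts s and s + 1, repeat on the rest) keeps m parts. Run m s and
  -- Skip m s describe what follows a kept part s: its run of s's, then the run of (s+1)'s.
  mutual
    data Greedy : ℕ → ℕ → List ℕ → Set where
      []   : ∀ {t} → Greedy 0 t []
      keep : ∀ {m t s p} → t ≤ s → Run m s p → Greedy (suc m) t p

    data Run (m s : ℕ) : List ℕ → Set where
      run-end : ∀ {y} → Skip m s y → Run m s (s ∷ y)
      run-∷   : ∀ {y} → Run m s y → Run m s (s ∷ y)

    data Skip (m s : ℕ) : List ℕ → Set where
      skip-end : ∀ {y} → Greedy m (2 + s) y → Skip m s y
      skip-∷   : ∀ {y} → Skip m s y → Skip m s (suc s ∷ y)

  run-head : ∀ {m s p} → Run m s p → ∃ λ y → p ≡ s ∷ y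
  run-head (run-end {y} _) = y , refl
  run-head (run-∷ {y} _)   = y , refl

  mutual
    greedy-≥ : ∀ {m t p} → Greedy m t p → All (t ≤_) p
    greedy-≥ []           = []
    greedy-≥ (keep t≤s r) = All.map (ℕ.≤-trans t≤s) (run-≥ r)

    run-≥ : ∀ {m s p} → Run m s p → All (s ≤_) p
    run-≥ (run-end k) = ℕ.≤-refl ∷ All.map ℕ.<⇒≤ (skip-> k)
    run-≥ (run-∷ r)   = ℕ.≤-refl ∷ run-≥ r

    skip-> : ∀ {m s y} → Skip m s y → All (s <_) y
    skip-> (skip-end g) = All.map ℕ.<⇒≤ (greedy-≥ g)
    skip-> (skip-∷ k)   = ℕ.≤-refl ∷ skip-> k

  mutual
    greedy-sorted : ∀ {m t p} → Greedy m t p → Linked _≤_ p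
    greedy-sorted []         = []
    greedy-sorted (keep _ r) = run-sorted r

    run-sorted : ∀ {m s p} → Run m s p → Linked _≤_ p
    run-sorted (run-end k) = Linked-∷ (All.map ℕ.<⇒≤ (skip-> k)) (skip-sorted k)
    run-sorted (run-∷ r)   = Linked-∷ (run-≥ r) (run-sorted r)

    skip-sorted : ∀ {m s y} → Skip m s y → Linked _≤_ y
    skip-sorted (skip-end g) = greedy-sorted g
    skip-sorted (skip-∷ k)   = Linked-∷ (skip-> k) (skip-sorted k)

  mutual
    greedy-exists : ∀ t p → Linked _≤_ (t ∷ p) → ∃ λ m → Greedy m t p
    greedy-exists t []      _          = 0 , []
    greedy-exists t (s ∷ p) (t≤s ∷ ps) = suc _ , keep t≤s (proj₂ (run-exists s p ps))

    run-exists : ∀ s p → Linked _≤_ (s ∷ p) → ∃ λ m → Run m s (s ∷ p)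
    run-exists s []      _          = 0 , run-end (skip-end [])
    run-exists s (x ∷ p) (s≤x ∷ ps) = run-exists′ s x p s≤x ps (s ℕ.≟ x)

    run-exists′ : ∀ s x p → s ≤ x → Linked _≤_ (x ∷ p) → Dec (s ≡ x) →
                  ∃ λ m → Run m s (s ∷ x ∷ p)
    run-exists′ s .s p _   ps (yes refl) = map₂ run-∷ (run-exists s p ps)
    run-exists′ s x  p s≤x ps (no s≢x)   =
      map₂ run-end (skip-exists′ s x p (ℕ.≤∧≢⇒< s≤x s≢x) ps (suc s ℕ.≟ x))

    skip-exists : ∀ s p → Linked _≤_ (suc s ∷ p) → ∃ λ m → Skip m s p
    skip-exists s []      _          = 0 , skip-end []
    skip-exists s (x ∷ p) (s<x ∷ ps) = skip-exists′ s x p s<x ps (suc s ℕ.≟ x)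

    skip-exists′ : ∀ s x p → s < x → Linked _≤_ (x ∷ p) → Dec (suc s ≡ x) →
                   ∃ λ m → Skip m s (x ∷ p)
    skip-exists′ s .(suc s) p _   ps (yes refl) = map₂ skip-∷ (skip-exists s p ps)
    skip-exists′ s x        p s<x ps (no s+1≢x) =
      suc _ , skip-end (keep (ℕ.≤∧≢⇒< s<x s+1≢x) (proj₂ (run-exists x p ps)))

  AscGap2 : List ℕ → Set
  AscGap2 = Linked (λ a b → a + 2 ≤ b)

  gap-trans : Transitive (λ a b → a + 2 ≤ b)
  gap-trans {a} a+2≤b b+2≤c = ℕ.≤-trans a+2≤b (ℕ.≤-trans (ℕ.m≤m+n _ 2) b+2≤c)

  ≤-gap-trans : ∀ {s x} → s ≤ x → ∀ {y} → x + 2 ≤ y → 2 + s ≤ y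
  ≤-gap-trans {s} s≤x x+2≤y = ℕ.≤-trans (ℕ.≤-reflexive (ℕ.+-comm 2 s)) (ℕ.≤-trans (ℕ.+-monoˡ-≤ 2 s≤x) x+2≤y)

  2+n≰n : ∀ {n} → 2 + n ≰ n
  2+n≰n h = ℕ.1+n≰n (ℕ.≤-trans (ℕ.n≤1+n _) h)

  mutual
    greedy-optimal : ∀ {m t p w} → Greedy m t p → w ⊆ p → AscGap2 w → length w ≤ m
    greedy-optimal []         [] _ = z≤n
    greedy-optimal (keep _ r) w⊆ ws = run-optimal r w⊆ ws

    run-optimal : ∀ {m s p w} → Run m s p → w ⊆ p → AscGap2 w → length w ≤ suc m
    run-optimal {w = []}    _ _  _  = z≤n
    run-optimal {w = x ∷ w} r w⊆ ws =
      s≤s (run-beyond r (∷ˡ⁻ w⊆) (Linked.tail ws) (All.map (≤-gap-trans s≤x) (Linked⇒All-head gap-trans ws)))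
      where
      s≤x = All.head (All-resp-⊆ w⊆ (run-≥ r))

    run-beyond : ∀ {m s p w} → Run m s p → w ⊆ p → AscGap2 w → All (2 + s ≤_) w → length w ≤ m
    run-beyond (run-end k) (_ ∷ʳ w⊆) ws above        = skip-beyond k w⊆ ws above
    run-beyond (run-∷ r)   (_ ∷ʳ w⊆) ws above        = run-beyond r w⊆ ws above
    run-beyond (run-end k) (refl ∷ _) _ (s+2≤s ∷ _)  = ⊥-elim (2+n≰n s+2≤s)
    run-beyond (run-∷ r)   (refl ∷ _) _ (s+2≤s ∷ _)  = ⊥-elim (2+n≰n s+2≤s)

    skip-beyond : ∀ {m s y w} → Skip m s y → w ⊆ y → AscGap2 w → All (2 + s ≤_) w → length w ≤ m
    skip-beyond (skip-end g) w⊆          ws _             = greedy-optimal g w⊆ ws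
    skip-beyond (skip-∷ k)   (_ ∷ʳ w⊆)   ws above         = skip-beyond k w⊆ ws above
    skip-beyond (skip-∷ k)   (refl ∷ _)  _  (s+2≤s+1 ∷ _) = ⊥-elim (ℕ.1+n≰n s+2≤s+1)

  GapChoice : ℕ → ℕ → List ℕ → Set
  GapChoice m t p = ∃ λ w → w ⊆ p × AscGap2 w × length w ≡ m × All (t ≤_) w

  mutual
    greedy-choice : ∀ {m t p} → Greedy m t p → GapChoice m t p
    greedy-choice []           = [] , [] , [] , refl , []
    greedy-choice (keep t≤s r) with run-choice r
    ... | w , w⊆ , ws , len , above = w , w⊆ , ws , len , All.map (ℕ.≤-trans t≤s) above

    run-choice : ∀ {m s p} → Run m s p → GapChoice (suc m) s p
    run-choice {s = s} (run-end k) with skip-choice k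
    ... | w , w⊆ , ws , len , above =
      s ∷ w , refl ∷ w⊆ , Linked-∷ (All.map (ℕ.≤-trans (ℕ.≤-reflexive (ℕ.+-comm s 2))) above) ws ,
      cong suc len , ℕ.≤-refl ∷ All.map (ℕ.≤-trans (ℕ.m≤n+m s 2)) above
    run-choice {s = s} (run-∷ r) with run-choice r
    ... | w , w⊆ , ws , len , above = w , s ∷ʳ w⊆ , ws , len , above

    skip-choice : ∀ {m s y} → Skip m s y → GapChoice m (2 + s) y
    skip-choice (skip-end g) = greedy-choice g
    skip-choice {s = s} (skip-∷ k) with skip-choice k
    ... | w , w⊆ , ws , len , above = w , suc s ∷ʳ w⊆ , ws , len , above

  greedy-μ₂ : ∀ {m t p} → Greedy m t p → IsMu2 (reverse p) m
  greedy-μ₂ {m} {p = p} g with greedy-choice g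
  ... | w , w⊆ , ws , len , _ =
    (reverse w , reverse⁺ w⊆ , Linked-reverse ws , trans (List.length-reverse w) len) ,
    λ s s⊆ ss → subst (_≤ m) (List.length-reverse s) (greedy-optimal g
                  (subst (reverse s ⊆_) (List.reverse-involutive p) (reverse⁺ s⊆)) (Linked-reverse ss))

  μ₂-unique : ∀ {p m m′} → IsMu2 p m → IsMu2 p m′ → m ≡ m′
  μ₂-unique ((s , s⊆ , ss , refl) , ≤m) ((s′ , s′⊆ , ss′ , refl) , ≤m′) =
    ℕ.≤-antisym (≤m′ s s⊆ ss) (≤m s′ s′⊆ ss′)

module GreedyEnumeration where

  open import Data.Nat as ℕ using (ℕ; zero; suc; _+_; _∸_; _≤_; _<_; _≤?_; z≤n; s≤s)
  import Data.Nat.Properties as ℕ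
  open import Data.Nat.ListAction using (sum)
  open import Data.List using (List; []; _∷_; [_]; _++_; map; concatMap)
  import Data.List.Properties as List
  open import Data.List.Membership.Propositional using (_∈_)
  open import Data.List.Membership.Propositional.Properties using (∈-++⁻; ∈-++⁺ˡ; ∈-++⁺ʳ; ∈-map⁻)
  open import Data.List.Relation.Unary.Any using (here)
  open import Data.List.Relation.Unary.All as All using (_∷_)
  open import Data.List.Relation.Unary.AllPairs using ([]; _∷_)
  open import Data.List.Relation.Unary.Unique.Propositional using (Unique)
  import Data.List.Relation.Unary.Unique.Propositional.Properties as Unique
  open import Data.Product using (_×_; _,_; proj₁; proj₂)
  open import Data.Sum using (inj₁; inj₂)
  open import Data.Empty using (⊥; ⊥-elim)
  open import Relation.Binary.PropositionalEquality hiding ([_])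
  open import Relation.Nullary using (yes; no)
  open import Data.Integer using () renaming (_+_ to _+ᶻ_; -_ to -ᶻ_)
  import Data.Integer.Properties as ℤ
  open import Data.Integer.Tactic.RingSolver using (solve-∀)
  open PowerSeries
  open Lists
  open SignedSums
  open GreedySelection

  mutual
    greedyList : ℕ → ℕ → ℕ → List (List ℕ)
    greedyList zero    t zero    = [ [] ]
    greedyList zero    t (suc n) = []
    greedyList (suc m) t n       = concatMap (λ s → runList m s n) (range t (suc n ∸ t))

    runList : ℕ → ℕ → ℕ → List (List ℕ)
    runList m s n = runList′ n m s n

    skipList : ℕ → ℕ → ℕ → List (List ℕ)
    skipList m s n = skipList′ n m s n

    -- The first argument is fuel: any fuel ≥ n gives the same list (runList′-fuel).
    runList′ : ℕ → ℕ → ℕ → ℕ → List (List ℕ)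
    runList′ zero    m s n = []
    runList′ (suc k) m s n =
      when (s ≤? n) (map (s ∷_) (skipList m s (n ∸ s) ++ runList′ k m s (n ∸ s)))

    skipList′ : ℕ → ℕ → ℕ → ℕ → List (List ℕ)
    skipList′ zero    m s n = greedyList m (2 + s) n
    skipList′ (suc k) m s n =
      greedyList m (2 + s) n ++ when (suc s ≤? n) (map (suc s ∷_) (skipList′ k m s (n ∸ suc s)))

  sum-∷ : ∀ {s n} y → s ≤ n → sum y ≡ n ∸ s → sum (s ∷ y) ≡ n
  sum-∷ {s} y s≤n sum≡ = trans (cong (λ z → s + z) sum≡) (ℕ.m+[n∸m]≡n s≤n)

  mutual
    greedyList-sound : ∀ m t n {p} → p ∈ greedyList m t n → Greedy m t p × sum p ≡ n
    greedyList-sound zero    t zero (here refl) = [] , refl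
    greedyList-sound (suc m) t n p∈ with ∈-concatMap-range⁻ (λ s → runList m s n) t (suc n ∸ t) p∈
    ... | s , t≤s , _ , p∈′ with runList′-sound n m s n p∈′
    ... | r , sum≡n = keep t≤s r , sum≡n

    runList′-sound : ∀ k m s n {p} → p ∈ runList′ k m s n → Run m s p × sum p ≡ n
    runList′-sound (suc k) m s n p∈ with ∈-when⁻ (s ≤? n) p∈
    ... | s≤n , p∈′ with ∈-map⁻ (s ∷_) p∈′
    ... | y , y∈ , refl with ∈-++⁻ (skipList m s (n ∸ s)) y∈
    ...   | inj₁ y∈skip with skipList′-sound (n ∸ s) m s (n ∸ s) y∈skip
    ...     | k , sum≡ = run-end k , sum-∷ y s≤n sum≡
    runList′-sound (suc k) m s n p∈ | s≤n , _ | y , _ , refl | inj₂ y∈run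
      with runList′-sound k m s (n ∸ s) y∈run
    ...     | r , sum≡ = run-∷ r , sum-∷ y s≤n sum≡

    skipList′-sound : ∀ k m s n {y} → y ∈ skipList′ k m s n → Skip m s y × sum y ≡ n
    skipList′-sound zero    m s n y∈ with greedyList-sound m (2 + s) n y∈
    ... | g , sum≡ = skip-end g , sum≡
    skipList′-sound (suc k) m s n y∈ with ∈-++⁻ (greedyList m (2 + s) n) y∈
    ... | inj₁ y∈g with greedyList-sound m (2 + s) n y∈g
    ...   | g , sum≡ = skip-end g , sum≡
    skipList′-sound (suc k) m s n y∈ | inj₂ y∈′ with ∈-when⁻ (suc s ≤? n) y∈′
    ... | s<n , y∈″ with ∈-map⁻ (suc s ∷_) y∈″
    ... | z , z∈ , refl with skipList′-sound k m s (n ∸ suc s) z∈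
    ...   | k′ , sum≡ = skip-∷ k′ , sum-∷ z s<n sum≡

  mutual
    greedyList-complete : ∀ {m t p} → Greedy m t p → 1 ≤ t → p ∈ greedyList m t (sum p)
    greedyList-complete [] _ = here refl
    greedyList-complete {suc m} {t} {p} (keep {s = s} t≤s r) 1≤t =
      ∈-concatMap-range⁺ (λ s → runList m s (sum p)) t (suc (sum p) ∸ t) t≤s s<
        (runList′-complete r (ℕ.≤-trans 1≤t t≤s) (sum p) ℕ.≤-refl)
      where
      s≤sum : s ≤ sum p
      s≤sum with run-head r
      ... | y , refl = ℕ.m≤m+n s (sum y)
      s< : s < t + (suc (sum p) ∸ t)
      s< = subst (s <_) (sym (ℕ.m+[n∸m]≡n (ℕ.≤-trans t≤s (ℕ.m≤n⇒m≤1+n s≤sum)))) (s≤s s≤sum)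

    runList′-complete : ∀ {m s p} → Run m s p → 1 ≤ s → ∀ k → sum p ≤ k → p ∈ runList′ k m s (sum p)
    runList′-complete {s = suc _} (run-end _) _ zero ()
    runList′-complete {s = suc _} (run-∷ _)   _ zero ()
    runList′-complete {m} {s} (run-end {y} sk) _ (suc k) _ =
      ∈-guarded-map (s ∷_) (λ r → skipList m s r ++ runList′ k m s r) refl
        (∈-++⁺ˡ (skipList′-complete sk (sum y) ℕ.≤-refl))
    runList′-complete {m} {s} (run-∷ {y} r) 1≤s (suc k) sum≤ =
      ∈-guarded-map (s ∷_) (λ r → skipList m s r ++ runList′ k m s r) refl
        (∈-++⁺ʳ (skipList m s (sum y))
          (runList′-complete r 1≤s k (ℕ.s≤s⁻¹ (ℕ.≤-trans (ℕ.+-monoˡ-≤ (sum y) 1≤s) sum≤))))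

    skipList′-complete : ∀ {m s y} → Skip m s y → ∀ k → sum y ≤ k → y ∈ skipList′ k m s (sum y)
    skipList′-complete (skip-end g) zero    _ = greedyList-complete g (s≤s z≤n)
    skipList′-complete (skip-end g) (suc k) _ = ∈-++⁺ˡ (greedyList-complete g (s≤s z≤n))
    skipList′-complete (skip-∷ _)   zero    ()
    skipList′-complete {m} {s} (skip-∷ {y} sk) (suc k) sum≤ =
      ∈-++⁺ʳ (greedyList m (2 + s) (sum (suc s ∷ y)))
        (∈-guarded-map (suc s ∷_) (skipList′ k m s) refl
          (skipList′-complete sk k (ℕ.≤-trans (ℕ.m≤n+m (sum y) s) (ℕ.s≤s⁻¹ sum≤))))

  mutual
    greedyList-unique : ∀ m t n → Unique (greedyList m t n)
    greedyList-unique zero    t zero    = All.[] ∷ []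
    greedyList-unique zero    t (suc n) = []
    greedyList-unique (suc m) t n       =
      concatMap-unique (λ s → runList m s n) (range-unique t (suc n ∸ t)) (λ s → runList′-unique n m s n) same-head
      where
      same-head : ∀ {s s′ p} → p ∈ runList m s n → p ∈ runList m s′ n → s ≡ s′
      same-head p∈ p∈′
        with run-head (proj₁ (runList′-sound n m _ n p∈)) | run-head (proj₁ (runList′-sound n m _ n p∈′))
      ... | _ , refl | _ , refl = refl

    runList′-unique : ∀ k m s n → Unique (runList′ k m s n)
    runList′-unique zero    m s n = []
    runList′-unique (suc k) m s n = when-unique (s ≤? n)
      (Unique.map⁺ List.∷-injectiveʳ (Unique.++⁺ (skipList′-unique r m s r) (runList′-unique k m s r) disjoint))
      where
      r = n ∸ s
      disjoint : ∀ {y} → y ∈ skipList m s r × y ∈ runList′ k m s r → ⊥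
      disjoint (y∈skip , y∈run)
        with skip-> (proj₁ (skipList′-sound r m s r y∈skip)) | run-head (proj₁ (runList′-sound k m s r y∈run))
      ... | s<s ∷ _ | _ , refl = ℕ.<-irrefl refl s<s

    skipList′-unique : ∀ k m s n → Unique (skipList′ k m s n)
    skipList′-unique zero    m s n = greedyList-unique m (2 + s) n
    skipList′-unique (suc k) m s n = Unique.++⁺ (greedyList-unique m (2 + s) n)
      (when-unique (suc s ≤? n) (Unique.map⁺ List.∷-injectiveʳ (skipList′-unique k m s (n ∸ suc s)))) disjoint
      where
      disjoint : ∀ {y} → y ∈ greedyList m (2 + s) n ×
                         y ∈ when (suc s ≤? n) (map (suc s ∷_) (skipList′ k m s (n ∸ suc s))) → ⊥
      disjoint (y∈g , y∈rest)
        with greedy-≥ (proj₁ (greedyList-sound m (2 + s) n y∈g))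
           | ∈-map⁻ (suc s ∷_) (proj₂ (∈-when⁻ (suc s ≤? n) y∈rest))
      ... | s+2≤s+1 ∷ _ | _ , _ , refl = ℕ.1+n≰n s+2≤s+1

  runList′-fuel : ∀ {k k′} m s {n} → n ≤ k → n ≤ k′ →
                  runList′ k m (suc s) n ≡ runList′ k′ m (suc s) n
  runList′-fuel {zero}  {zero}   m s _   _    = refl
  runList′-fuel {zero}  {suc k′} m s z≤n _    = refl
  runList′-fuel {suc k} {zero}   m s _   z≤n  = refl
  runList′-fuel {suc k} {suc k′} m s {n} n≤k n≤k′ =
    cong (λ L → when (suc s ≤? n) (map (suc s ∷_) (skipList m (suc s) (n ∸ suc s) ++ L)))
         (runList′-fuel m s (n≤1+k⇒n∸1+s≤k s n≤k) (n≤1+k⇒n∸1+s≤k s n≤k′))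

  skipList′-fuel : ∀ {k k′} m s {n} → n ≤ k → n ≤ k′ → skipList′ k m s n ≡ skipList′ k′ m s n
  skipList′-fuel {zero}  {zero}   m s _   _   = refl
  skipList′-fuel {zero}  {suc k′} m s z≤n _   = sym (List.++-identityʳ (greedyList m (2 + s) 0))
  skipList′-fuel {suc k} {zero}   m s _   z≤n = List.++-identityʳ (greedyList m (2 + s) 0)
  skipList′-fuel {suc k} {suc k′} m s {n} n≤k n≤k′ =
    cong (λ L → greedyList m (2 + s) n ++ when (suc s ≤? n) (map (suc s ∷_) L))
         (skipList′-fuel m s (n≤1+k⇒n∸1+s≤k s n≤k) (n≤1+k⇒n∸1+s≤k s n≤k′))

  runList′-small : ∀ k m {s n} → n < s → runList′ k m s n ≡ []
  runList′-small zero    m     _   = refl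
  runList′-small (suc k) m {s} {n} n<s with s ≤? n
  ... | yes s≤n = ⊥-elim (ℕ.<⇒≱ n<s s≤n)
  ... | no  _   = refl

  A Ea Eb : ℕ → ℕ → Series
  A  m t n = Σ± (greedyList m t n)
  Ea m s n = Σ± (runList m s n)
  Eb m s n = Σ± (skipList m s n)

  A-zero : ∀ t → A 0 t ≗ 𝟙
  A-zero t zero    = refl
  A-zero t (suc n) = refl

  A-∣ : ∀ m t → q^ t ∣ A (suc m) t
  A-∣ m t {j} j<t = cong (λ k → Σ± (concatMap (λ s → runList m s j) (range t k))) (ℕ.m≤n⇒m∸n≡0 j<t)

  A-split : ∀ m t → A (suc m) t ≗ A (suc m) (suc t) ⊕ Ea m t
  A-split m t n with t ≤? n
  ... | yes t≤n = begin
    Σ± (concatMap runs (range t (suc n ∸ t)))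
      ≡⟨ cong (λ k → Σ± (concatMap runs (range t k))) (ℕ.+-∸-assoc 1 t≤n) ⟩
    Σ± (runList m t n ++ concatMap runs (range (suc t) (n ∸ t)))
      ≡⟨ Σ±-++ (runList m t n) _ ⟩
    Ea m t n +ᶻ A (suc m) (suc t) n
      ≡⟨ ℤ.+-comm (Ea m t n) _ ⟩
    A (suc m) (suc t) n +ᶻ Ea m t n ∎
    where
    open ≡-Reasoning
    runs = λ s → runList m s n
  ... | no t≰n = trans (A-∣ m t n<t)
    (sym (cong₂ _+ᶻ_ (A-∣ m (suc t) (ℕ.m≤n⇒m≤1+n n<t)) (cong Σ± (runList′-small n m n<t))))
    where
    n<t = ℕ.≰⇒> t≰n

  Ea-unfold : ∀ m s → Ea m (suc s) ≗ ⊝ q^ suc s · (Eb m (suc s) ⊕ Ea m (suc s))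
  Ea-unfold m s zero    = refl
  Ea-unfold m s (suc n) =
    Σ±-guarded (suc s ≤? suc n) (suc s ∷_) 1 (λ _ → refl) _ (Eb m (suc s) ⊕ Ea m (suc s)) λ _ →
      trans (Σ±-++ (skipList m (suc s) r) _)
            (cong (λ L → Eb m (suc s) r +ᶻ Σ± L) (runList′-fuel m s (n≤1+k⇒n∸1+s≤k s ℕ.≤-refl) ℕ.≤-refl))
    where
    r = n ∸ s

  Eb-unfold : ∀ m s → Eb m (suc s) ≗ A m (3 + s) ⊕ ⊝ q^ (2 + s) · Eb m (suc s)
  Eb-unfold m s zero    = sym (ℤ.+-identityʳ (A m (3 + s) 0))
  Eb-unfold m s (suc n) = trans (Σ±-++ (greedyList m (3 + s) (suc n)) _) (cong (A m (3 + s) (suc n) +ᶻ_)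
    (Σ±-guarded (2 + s ≤? suc n) (2 + s ∷_) 1 (λ _ → refl) _ (Eb m (suc s)) λ _ →
      cong Σ± (skipList′-fuel m (suc s) (n≤1+k⇒n∸1+s≤k (suc s) (ℕ.≤-refl {suc n})) ℕ.≤-refl)))

  Ea-rec : ∀ m s → [1+q^ suc s ] Ea m (suc s) ≗ ⊝ q^ suc s · Eb m (suc s)
  Ea-rec m s n = trans (cong (_+ᶻ (q^ suc s · Ea m (suc s)) n)
                             (trans (Ea-unfold m s n) (cong -ᶻ_ (⊕-homo (shift-linear (suc s)) _ _ n))))
                       (cancel _ _)
    where
    open ShiftLinear
    cancel : ∀ a b → -ᶻ (b +ᶻ a) +ᶻ a ≡ -ᶻ b
    cancel = solve-∀

  Eb-rec : ∀ m s → [1+q^ 2 + s ] Eb m (suc s) ≗ A m (3 + s)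
  Eb-rec m s n = trans (cong (_+ᶻ (q^ 2 + s · Eb m (suc s)) n) (Eb-unfold m s n)) (cancel _ _)
    where
    cancel : ∀ a b → a +ᶻ -ᶻ b +ᶻ b ≡ a
    cancel = solve-∀

module DistinctOddParts where

  open import Data.Nat as ℕ using (ℕ; zero; suc; _+_; _∸_; _≤_; _<_; _≤?_; _%_; z≤n; s≤s)
  import Data.Nat.Properties as ℕ
  open import Data.Nat.ListAction using (sum)
  open import Data.List using (List; []; _∷_; [_]; _++_; map; length)
  import Data.List.Properties as List
  open import Data.List.Membership.Propositional using (_∈_)
  open import Data.List.Membership.Propositional.Properties using (∈-++⁻; ∈-++⁺ˡ; ∈-++⁺ʳ; ∈-map⁻)
  open import Data.List.Relation.Unary.Any using (here)
  open import Data.List.Relation.Unary.All as All using (All; []; _∷_)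
  open import Data.List.Relation.Unary.Linked as Linked using (Linked; []; _∷_)
  import Data.List.Relation.Unary.Linked.Properties as Linked
  import Data.List.Relation.Unary.All.Properties as All
  open import Data.Nat.Tactic.RingSolver using (solve-∀)
  open import Data.List.Relation.Unary.AllPairs using ([]; _∷_)
  open import Data.List.Relation.Unary.Unique.Propositional using (Unique)
  import Data.List.Relation.Unary.Unique.Propositional.Properties as Unique
  open import Data.Product using (∃; _×_; _,_; proj₁; proj₂)
  open import Data.Sum using (inj₁; inj₂)
  open import Data.Empty using (⊥; ⊥-elim)
  open import Function using (_∘_)
  open import Relation.Binary.PropositionalEquality hiding ([_])
  open import Relation.Nullary using (yes; no)
  open import Data.Integer using () renaming (_+_ to _+ᶻ_; -_ to -ᶻ_)
  open import Data.Integer.Tactic.RingSolver renaming (solve-∀ to solveℤ-∀)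
  open PowerSeries
  open Lists
  open SignedSums

  Odd : ℕ → Set
  Odd k = k % 2 ≡ 1

  OddAscending : ℕ → List ℕ → Set
  OddAscending m p = Linked _<_ p × All Odd p × length p ≡ m

  addTwo : List ℕ → List ℕ
  addTwo = map (2 ℕ.+_)

  -- k is fuel. Either 1 is a part (drop it and subtract 2 from the other parts) or it is not
  -- (subtract 2 from every part).
  oddList′ : ℕ → ℕ → ℕ → List (List ℕ)
  oddList′ k       zero    zero    = [ [] ]
  oddList′ k       zero    (suc n) = []
  oddList′ zero    (suc m) n       = []
  oddList′ (suc k) (suc m) n       =
    when (suc m + m ≤? n) (map ((1 ∷_) ∘ addTwo) (oddList′ k m (n ∸ (suc m + m))))
    ++ when (suc m + suc m ≤? n) (map addTwo (oddList′ k (suc m) (n ∸ (suc m + suc m))))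

  oddList : ℕ → ℕ → List (List ℕ)
  oddList m n = oddList′ n m n

  sum-addTwo : ∀ p → sum (addTwo p) ≡ length p + length p + sum p
  sum-addTwo []      = refl
  sum-addTwo (x ∷ p) = trans (cong (λ z → 2 + x + z) (sum-addTwo p)) (rearrange x (length p) (sum p))
    where
    rearrange : ∀ x l s → 2 + x + (l + l + s) ≡ suc l + suc l + (x + s)
    rearrange = solve-∀

  addTwo-oddAscending⁺ : ∀ {m p} → OddAscending m p → OddAscending m (addTwo p)
  addTwo-oddAscending⁺ {p = p} (inc , odd , len) =
    Linked.map⁺ (Linked.map (λ x<y → s≤s (s≤s x<y)) inc) , All.map⁺ odd ,
    trans (List.length-map (2 ℕ.+_) p) len

  addTwo-≥2 : ∀ p → All (2 ≤_) (addTwo p)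
  addTwo-≥2 p = All.map⁺ (All.tabulate (λ _ → s≤s (s≤s z≤n)))

  addTwo-oddAscending⁻ : ∀ {m} q → OddAscending m (addTwo q) → OddAscending m q
  addTwo-oddAscending⁻ q (inc , odd , len) =
    Linked.map (λ 2+x<2+y → ℕ.s≤s⁻¹ (ℕ.s≤s⁻¹ 2+x<2+y)) (Linked.map⁻ inc) , All.map⁻ odd ,
    trans (sym (List.length-map (2 ℕ.+_) q)) len

  addTwo-surjective : ∀ {p} → All (2 ≤_) p → ∃ λ q → p ≡ addTwo q
  addTwo-surjective []               = [] , refl
  addTwo-surjective (2≤x ∷ 2≤p) with addTwo-surjective 2≤p
  ... | q , refl = _ , cong (_∷ addTwo q) (sym (ℕ.m+[n∸m]≡n 2≤x))

  oddList′-sound : ∀ k m n {p} → p ∈ oddList′ k m n → OddAscending m p × sum p ≡ n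
  oddList′-sound k       zero    zero (here refl) = ([] , [] , refl) , refl
  oddList′-sound (suc k) (suc m) n p∈ with ∈-++⁻ (when (suc m + m ≤? n) _) p∈
  ... | inj₁ p∈₁ with ∈-when⁻ (suc m + m ≤? n) p∈₁
  ... | c≤n , p∈₂ with ∈-map⁻ ((1 ∷_) ∘ addTwo) p∈₂
  ... | q , q∈ , refl with oddList′-sound k m _ q∈
  ... | asc@(inc , odd , len) , sum≡ =
    (Linked-∷ (addTwo-≥2 q) inc′ , refl ∷ odd′ , cong suc len′) ,
    trans (cong suc (trans (sum-addTwo q) (cong₂ (λ l s → l + l + s) len sum≡))) (ℕ.m+[n∸m]≡n c≤n)
    where
    inc′ = proj₁ (addTwo-oddAscending⁺ asc)
    odd′ = proj₁ (proj₂ (addTwo-oddAscending⁺ asc))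
    len′ = proj₂ (proj₂ (addTwo-oddAscending⁺ asc))
  oddList′-sound (suc k) (suc m) n p∈ | inj₂ p∈₁ with ∈-when⁻ (suc m + suc m ≤? n) p∈₁
  ... | c≤n , p∈₂ with ∈-map⁻ addTwo p∈₂
  ... | q , q∈ , refl with oddList′-sound k (suc m) _ q∈
  ... | asc@(_ , _ , len) , sum≡ =
    addTwo-oddAscending⁺ asc ,
    trans (trans (sum-addTwo q) (cong₂ (λ l s → l + l + s) len sum≡)) (ℕ.m+[n∸m]≡n c≤n)

  odd⇒≥1 : ∀ {x} → Odd x → 1 ≤ x
  odd⇒≥1 {suc _} _ = s≤s z≤n

  oddList′-complete : ∀ {m p} → OddAscending m p → ∀ k → sum p ≤ k → p ∈ oddList′ k m (sum p)
  oddList′-complete {zero}  {[]} _ k _ = here refl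
  oddList′-complete {suc m} {x ∷ q} (_ , odd ∷ _ , _) zero sum≤0 =
    ⊥-elim (ℕ.<-irrefl refl (ℕ.<-≤-trans (ℕ.≤-trans (odd⇒≥1 odd) (ℕ.m≤m+n x (sum q))) sum≤0))
  oddList′-complete {suc m} {x ∷ q} (inc , odd ∷ odds , len) (suc k) sum≤ with x ℕ.≟ 1
  ... | yes refl with addTwo-surjective (Linked⇒All-head ℕ.<-trans inc)
  ... | q′ , refl = ∈-++⁺ˡ (∈-guarded-map ((1 ∷_) ∘ addTwo) (oddList′ k m) sum≡
          (oddList′-complete asc′ k
            (ℕ.≤-trans (ℕ.m≤n+m (sum q′) (m + m)) (ℕ.s≤s⁻¹ (subst (_≤ suc k) sum≡ sum≤)))))
    where
    asc′ : OddAscending m q′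
    asc′ = addTwo-oddAscending⁻ q′ (Linked.tail inc , odds , ℕ.suc-injective len)
    sum≡ : sum (1 ∷ addTwo q′) ≡ suc m + m + sum q′
    sum≡ = cong suc (trans (sum-addTwo q′) (cong (λ l → l + l + sum q′) (proj₂ (proj₂ asc′))))
  oddList′-complete {suc m} {x ∷ q} asc@(inc , odd ∷ _ , _) (suc k) sum≤ | no x≢1
    with addTwo-surjective (2≤x ∷ All.map (ℕ.≤-trans 2≤x ∘ ℕ.<⇒≤) (Linked⇒All-head ℕ.<-trans inc))
    where
    2≤x : 2 ≤ x
    2≤x = ℕ.≤∧≢⇒< (odd⇒≥1 odd) (x≢1 ∘ sym)
  ... | p′ , p≡ = subst (λ p → p ∈ oddList′ (suc k) (suc m) (sum p)) (sym p≡)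
    (∈-++⁺ʳ (when (suc m + m ≤? sum (addTwo p′)) _)
      (∈-guarded-map addTwo (oddList′ k (suc m)) sum≡
        (oddList′-complete asc′ k (ℕ.≤-trans (ℕ.m≤n+m (sum p′) (m + suc m))
          (ℕ.s≤s⁻¹ (subst (_≤ suc k) sum≡ (subst (λ p → sum p ≤ suc k) p≡ sum≤)))))))
    where
    asc′ : OddAscending (suc m) p′
    asc′ = addTwo-oddAscending⁻ p′ (subst (OddAscending (suc m)) p≡ asc)
    sum≡ : sum (addTwo p′) ≡ suc m + suc m + sum p′
    sum≡ = trans (sum-addTwo p′) (cong (λ l → l + l + sum p′) (proj₂ (proj₂ asc′)))

  oddList′-unique : ∀ k m n → Unique (oddList′ k m n)
  oddList′-unique k       zero    zero    = All.[] ∷ []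
  oddList′-unique k       zero    (suc n) = []
  oddList′-unique zero    (suc m) n       = []
  oddList′-unique (suc k) (suc m) n       = Unique.++⁺
    (when-unique (suc m + m ≤? n) (Unique.map⁺ (addTwo-injective ∘ List.∷-injectiveʳ) (oddList′-unique k m _)))
    (when-unique (suc m + suc m ≤? n) (Unique.map⁺ addTwo-injective (oddList′-unique k (suc m) _)))
    disjoint
    where
    addTwo-injective : ∀ {p q} → addTwo p ≡ addTwo q → p ≡ q
    addTwo-injective = List.map-injective (ℕ.+-cancelˡ-≡ 2 _ _)
    disjoint : ∀ {p} → p ∈ when (suc m + m ≤? n) (map ((1 ∷_) ∘ addTwo) (oddList′ k m (n ∸ (suc m + m)))) ×
                       p ∈ when (suc m + suc m ≤? n) (map addTwo (oddList′ k (suc m) (n ∸ (suc m + suc m)))) → ⊥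
    disjoint (p∈₁ , p∈₂) with ∈-map⁻ ((1 ∷_) ∘ addTwo) (proj₂ (∈-when⁻ (suc m + m ≤? n) p∈₁))
                            | ∈-map⁻ addTwo (proj₂ (∈-when⁻ (suc m + suc m ≤? n) p∈₂))
    ... | _ , _ , refl | [] , _ , ()
    ... | _ , _ , refl | _ ∷ _ , _ , ()

  oddList′-fuel : ∀ {k k′} m {n} → n ≤ k → n ≤ k′ → oddList′ k m n ≡ oddList′ k′ m n
  oddList′-fuel {k}     {k′}     zero    {zero}  _   _    = refl
  oddList′-fuel {k}     {k′}     zero    {suc n} _   _    = refl
  oddList′-fuel {zero}  {zero}   (suc m) _   _    = refl
  oddList′-fuel {zero}  {suc k′} (suc m) z≤n _    = refl
  oddList′-fuel {suc k} {zero}   (suc m) _   z≤n  = refl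
  oddList′-fuel {suc k} {suc k′} (suc m) {n} n≤k n≤k′ = cong₂ _++_
    (cong (λ L → when (suc m + m ≤? n) (map ((1 ∷_) ∘ addTwo) L))
          (oddList′-fuel m (n≤1+k⇒n∸1+s≤k (m + m) n≤k) (n≤1+k⇒n∸1+s≤k (m + m) n≤k′)))
    (cong (λ L → when (suc m + suc m ≤? n) (map addTwo L))
          (oddList′-fuel (suc m) (n≤1+k⇒n∸1+s≤k (m + suc m) n≤k) (n≤1+k⇒n∸1+s≤k (m + suc m) n≤k′)))

  H : ℕ → Series
  H m n = Σ± (oddList m n)

  H-zero : H 0 ≗ 𝟙
  H-zero zero    = refl
  H-zero (suc n) = refl

  H-∣ : ∀ m → q^ 1 ∣ H (suc m)
  H-∣ m {zero}  _             = refl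
  H-∣ m {suc _} (s≤s ())

  H-unfold : ∀ m → H (suc m) ≗ ⊝ q^ suc m + m · H m ⊕ q^ suc m + suc m · H (suc m)
  H-unfold m zero    = refl
  H-unfold m (suc n) = trans (Σ±-++ (when (suc m + m ≤? suc n) _) _) (cong₂ _+ᶻ_
    (Σ±-guarded (suc m + m ≤? suc n) ((1 ∷_) ∘ addTwo) 1 (cong suc ∘ List.length-map (2 ℕ.+_)) _ (H m) λ _ →
       cong Σ± (oddList′-fuel m (n≤1+k⇒n∸1+s≤k (m + m) ℕ.≤-refl) ℕ.≤-refl))
    (Σ±-guarded (suc m + suc m ≤? suc n) addTwo 0 (List.length-map (2 ℕ.+_)) _ (H (suc m)) λ _ →
       cong Σ± (oddList′-fuel (suc m) (n≤1+k⇒n∸1+s≤k (m + suc m) ℕ.≤-refl) ℕ.≤-refl)))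

  H-rec : ∀ m → [1-q^ suc m + suc m ] H (suc m) ≗ ⊝ q^ suc m + m · H m
  H-rec m n = trans (cong (_+ᶻ -ᶻ (q^ suc m + suc m · H (suc m)) n) (H-unfold m n)) (cancel _ _)
    where
    cancel : ∀ a b → a +ᶻ b +ᶻ -ᶻ b ≡ a
    cancel = solveℤ-∀

module Counting where

  open import Data.Nat as ℕ using (ℕ; suc; _+_; _≤_; _%_; z≤n; s≤s)
  import Data.Nat.Properties as ℕ
  open import Data.Nat.DivMod using (m%n<n)
  open import Data.Nat.ListAction using (sum)
  open import Data.Integer as ℤ using (+_; -_; _-_; 1ℤ) renaming (_+_ to _+ᶻ_)
  import Data.Integer.Properties as ℤ
  open import Data.Integer.Tactic.RingSolver using (solve-∀)
  open import Data.List using (List; []; _∷_; _++_; map; concatMap; filter; length; reverse)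
  import Data.List.Properties as List
  open import Data.List.Membership.Propositional using (_∈_)
  open import Data.List.Membership.Propositional.Properties using (∈-map⁻; ∈-map⁺; ∈-filter⁺; ∈-filter⁻)
  open import Data.List.Relation.Unary.All as All using (All)
  open import Data.List.Relation.Unary.Unique.Propositional using (Unique)
  import Data.List.Relation.Unary.Unique.Propositional.Properties as Unique
  open import Data.List.Relation.Binary.Sublist.Propositional.Properties using (length-mono-≤)
  open import Data.Product using (∃; _×_; _,_; proj₁; proj₂)
  open import Data.Sum using (_⊎_; inj₁; inj₂)
  open import Function using (mk⇔)
  open import Relation.Binary.PropositionalEquality
  open import Relation.Nullary using (Dec)
  open Lists
  open SignedSums
  open GreedySelection
  open GreedyEnumeration
  open DistinctOddParts

  A≗H : ∀ m → A m 1 ≗ H m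
  A≗H = SeriesIdentity.A≗H A Ea Eb H A-zero A-split Ea-rec Eb-rec A-∣ H-zero H-rec H-∣

  SumParity : ℕ → List ℕ → Set
  SumParity b p = ∃ λ m → IsMu2 p m × (ℓ p + m) % 2 ≡ b

  parity? : ∀ b m (p : List ℕ) → Dec ((length p + m) % 2 ≡ b)
  parity? b m p = (length p + m) % 2 ℕ.≟ b

  -- The generators list parts in increasing order; partitions in Defs are nonincreasing.
  partitionBlock : ℕ → ℕ → ℕ → List (List ℕ)
  partitionBlock b n m = map reverse (filter (parity? b m) (greedyList m 1 n))

  partitionList : ℕ → ℕ → List (List ℕ)
  partitionList b n = concatMap (partitionBlock b n) (range 0 (suc n))

  partitionBlock-sound : ∀ b n m {x} → x ∈ partitionBlock b n m →
                         IsPartition n x × IsMu2 x m × (ℓ x + m) % 2 ≡ b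
  partitionBlock-sound b n m x∈ with ∈-map⁻ reverse x∈
  ... | p , p∈ , refl with ∈-filter⁻ (parity? b m) p∈
  ... | p∈′ , par with greedyList-sound m 1 n p∈′
  ... | g , sum≡ =
    (All-reverse (greedy-≥ g) , Linked-reverse (greedy-sorted g) , trans (sum-reverse p) sum≡) ,
    greedy-μ₂ g , subst (λ l → (l + m) % 2 ≡ b) (sym (List.length-reverse p)) par

  partitionList-enumerates : ∀ b n → Enumerates (λ x → IsPartition n x × SumParity b x) (partitionList b n)
  partitionList-enumerates b n = unique , λ x → mk⇔ (sound x) (complete x)
    where
    unique : Unique (partitionList b n)
    unique = concatMap-unique (partitionBlock b n) (range-unique 0 (suc n))
      (λ m → Unique.map⁺ List.reverse-injective (Unique.filter⁺ (parity? b m) (greedyList-unique m 1 n)))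
      (λ x∈ x∈′ → μ₂-unique (proj₁ (proj₂ (partitionBlock-sound b n _ x∈)))
                            (proj₁ (proj₂ (partitionBlock-sound b n _ x∈′))))

    sound : ∀ x → x ∈ partitionList b n → IsPartition n x × SumParity b x
    sound x x∈ with ∈-concatMap-range⁻ (partitionBlock b n) 0 (suc n) x∈
    ... | m , _ , _ , x∈′ with partitionBlock-sound b n m x∈′
    ... | part , μ , par = part , m , μ , par

    complete : ∀ x → IsPartition n x × SumParity b x → x ∈ partitionList b n
    complete x ((pos , sorted , refl) , m′ , μ′ , par)
      with greedy-exists 1 (reverse x) (Linked-∷ (All-reverse pos) (Linked-reverse sorted))
    ... | m , g = ∈-concatMap-range⁺ (partitionBlock b n) 0 (suc n) z≤n (s≤s m≤n)
        (subst (_∈ partitionBlock b n m) (List.reverse-involutive x)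
          (∈-map⁺ reverse (∈-filter⁺ (parity? b m) p∈ par′)))
      where
      μ : IsMu2 x m
      μ = subst (λ y → IsMu2 y m) (List.reverse-involutive x) (greedy-μ₂ g)
      m≡m′ : m ≡ m′
      m≡m′ = μ₂-unique μ μ′
      p∈ : reverse x ∈ greedyList m 1 (sum x)
      p∈ = subst (λ s → reverse x ∈ greedyList m 1 s) (sum-reverse x) (greedyList-complete g (s≤s z≤n))
      par′ : (length (reverse x) + m) % 2 ≡ b
      par′ = subst₂ (λ l k → (l + k) % 2 ≡ b) (sym (List.length-reverse x)) (sym m≡m′) par
      m≤n : m ≤ sum x
      m≤n with proj₁ μ
      ... | w , w⊆ , _ , refl = ℕ.≤-trans (length-mono-≤ w⊆) (length≤sum pos)

  distinctOddBlock : ℕ → ℕ → List (List ℕ)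
  distinctOddBlock n m = map reverse (oddList m n)

  distinctOddList : ℕ → List (List ℕ)
  distinctOddList n = concatMap (distinctOddBlock n) (range 0 (suc n))

  distinctOddBlock-sound : ∀ n m {x} → x ∈ distinctOddBlock n m → IsDistinctOddPartition n x × length x ≡ m
  distinctOddBlock-sound n m x∈ with ∈-map⁻ reverse x∈
  ... | p , p∈ , refl with oddList′-sound n m n p∈
  ... | (inc , odd , len) , sum≡ =
    (All-reverse odd , Linked-reverse inc , trans (sum-reverse p) sum≡) , trans (List.length-reverse p) len

  distinctOddList-enumerates : ∀ n → Enumerates (IsDistinctOddPartition n) (distinctOddList n)
  distinctOddList-enumerates n = unique , λ x → mk⇔ (sound x) (complete x)
    where
    unique : Unique (distinctOddList n)
    unique = concatMap-unique (distinctOddBlock n) (range-unique 0 (suc n))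
      (λ m → Unique.map⁺ List.reverse-injective (oddList′-unique n m n))
      (λ x∈ x∈′ → trans (sym (proj₂ (distinctOddBlock-sound n _ x∈))) (proj₂ (distinctOddBlock-sound n _ x∈′)))

    sound : ∀ x → x ∈ distinctOddList n → IsDistinctOddPartition n x
    sound x x∈ with ∈-concatMap-range⁻ (distinctOddBlock n) 0 (suc n) x∈
    ... | m , _ , _ , x∈′ = proj₁ (distinctOddBlock-sound n m x∈′)

    complete : ∀ x → IsDistinctOddPartition n x → x ∈ distinctOddList n
    complete x (odd , dec , refl) =
      ∈-concatMap-range⁺ (distinctOddBlock n) 0 (suc n) z≤n (s≤s (length≤sum (All.map odd⇒≥1 odd)))
        (subst (_∈ distinctOddBlock n (length x)) (List.reverse-involutive x) (∈-map⁺ reverse p∈))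
      where
      p∈ : reverse x ∈ oddList (length x) (sum x)
      p∈ = subst (λ s → reverse x ∈ oddList′ s (length x) s) (sum-reverse x)
        (oddList′-complete (Linked-reverse dec , All-reverse odd , List.length-reverse x) (sum (reverse x)) ℕ.≤-refl)

  ±-by-parity : ∀ m (p : List ℕ) → ±[ (length p + m) % 2 ] 1ℤ ≡ ±[ m ] ±[ length p ] 1ℤ
  ±-by-parity m p = sym (trans (±-± m (length p) 1ℤ)
    (trans (cong (λ k → ±[ k ] 1ℤ) (ℕ.+-comm m (length p))) (±-mod-2 (length p + m) 1ℤ)))

  0≢1 : 0 ≢ 1
  0≢1 ()

  parity-cases : ∀ k → k % 2 ≡ 0 ⊎ k % 2 ≡ 1
  parity-cases k with k % 2 | m%n<n k 2
  ... | 0 | _ = inj₁ refl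
  ... | 1 | _ = inj₂ refl
  ... | suc (suc _) | s≤s (s≤s ())

  filter-parity-∷ : ∀ m p (L : List (List ℕ)) →
    + length (filter (parity? 0 m) (p ∷ L)) - + length (filter (parity? 1 m) (p ∷ L))
    ≡ ±[ (length p + m) % 2 ] 1ℤ +ᶻ (+ length (filter (parity? 0 m) L) - + length (filter (parity? 1 m) L))
  filter-parity-∷ m p L with parity-cases (length p + m)
  ... | inj₁ even
    rewrite List.filter-accept (parity? 0 m) {x = p} {xs = L} even
          | List.filter-reject (parity? 1 m) {x = p} {xs = L} (λ odd → 0≢1 (trans (sym even) odd))
          | even
    = shuffle (+ length (filter (parity? 0 m) L)) (+ length (filter (parity? 1 m) L))
    where
    shuffle : ∀ x y → 1ℤ +ᶻ x - y ≡ 1ℤ +ᶻ (x - y)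
    shuffle = solve-∀
  ... | inj₂ odd
    rewrite List.filter-reject (parity? 0 m) {x = p} {xs = L} (λ even → 0≢1 (trans (sym even) odd))
          | List.filter-accept (parity? 1 m) {x = p} {xs = L} odd
          | odd
    = shuffle (+ length (filter (parity? 0 m) L)) (+ length (filter (parity? 1 m) L))
    where
    shuffle : ∀ x y → x - (1ℤ +ᶻ y) ≡ - 1ℤ +ᶻ (x - y)
    shuffle = solve-∀

  filter-parity-difference : ∀ m (L : List (List ℕ)) →
    + length (filter (parity? 0 m) L) - + length (filter (parity? 1 m) L) ≡ ±[ m ] Σ± L
  filter-parity-difference m []      = sym (±-0 m)
  filter-parity-difference m (p ∷ L) = begin
    + length (filter (parity? 0 m) (p ∷ L)) - + length (filter (parity? 1 m) (p ∷ L))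
      ≡⟨ filter-parity-∷ m p L ⟩
    ±[ (length p + m) % 2 ] 1ℤ +ᶻ (+ length (filter (parity? 0 m) L) - + length (filter (parity? 1 m) L))
      ≡⟨ cong₂ _+ᶻ_ (±-by-parity m p) (filter-parity-difference m L) ⟩
    ±[ m ] ±[ length p ] 1ℤ +ᶻ ±[ m ] Σ± L
      ≡⟨ ±-+ m (±[ length p ] 1ℤ) (Σ± L) ⟨
    ±[ m ] Σ± (p ∷ L) ∎
    where open ≡-Reasoning

  block-difference : ∀ n m →
    + length (partitionBlock 0 n m) - + length (partitionBlock 1 n m) ≡ + length (distinctOddBlock n m)
  block-difference n m = begin
    + length (partitionBlock 0 n m) - + length (partitionBlock 1 n m)
      ≡⟨ cong₂ (λ a b → + a - + b) (List.length-map reverse (filter (parity? 0 m) (greedyList m 1 n)))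
                                   (List.length-map reverse (filter (parity? 1 m) (greedyList m 1 n))) ⟩
    + length (filter (parity? 0 m) (greedyList m 1 n)) - + length (filter (parity? 1 m) (greedyList m 1 n))
      ≡⟨ filter-parity-difference m (greedyList m 1 n) ⟩
    ±[ m ] A m 1 n                         ≡⟨ cong ±[ m ]_ (A≗H m n) ⟩
    ±[ m ] H m n                           ≡⟨ cong ±[ m ]_ (Σ±-uniform m (oddList m n) lengths) ⟩
    ±[ m ] ±[ m ] (+ length (oddList m n)) ≡⟨ ±-involutive m _ ⟩
    + length (oddList m n)                 ≡⟨ cong +_ (List.length-map reverse (oddList m n)) ⟨
    + length (distinctOddBlock n m)        ∎
    where
    open ≡-Reasoning
    lengths : All (λ p → length p ≡ m) (oddList m n)
    lengths = All.tabulate (λ p∈ → proj₂ (proj₂ (proj₁ (oddList′-sound n m n p∈))))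

  concatMap-length-difference : ∀ (f g h : ℕ → List (List ℕ)) →
    (∀ m → + length (f m) - + length (g m) ≡ + length (h m)) →
    ∀ ms → + length (concatMap f ms) - + length (concatMap g ms) ≡ + length (concatMap h ms)
  concatMap-length-difference f g h diff []       = refl
  concatMap-length-difference f g h diff (m ∷ ms) = begin
    + length (f m ++ concatMap f ms) - + length (g m ++ concatMap g ms)
      ≡⟨ cong₂ _-_ (length-++ (f m) (concatMap f ms)) (length-++ (g m) (concatMap g ms)) ⟩
    (+ length (f m) +ᶻ + length (concatMap f ms)) - (+ length (g m) +ᶻ + length (concatMap g ms))
      ≡⟨ interchange (+ length (f m)) (+ length (concatMap f ms)) (+ length (g m)) (+ length (concatMap g ms)) ⟩
    (+ length (f m) - + length (g m)) +ᶻ (+ length (concatMap f ms) - + length (concatMap g ms))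
      ≡⟨ cong₂ _+ᶻ_ (diff m) (concatMap-length-difference f g h diff ms) ⟩
    + length (h m) +ᶻ + length (concatMap h ms)
      ≡⟨ length-++ (h m) (concatMap h ms) ⟨
    + length (h m ++ concatMap h ms) ∎
    where
    open ≡-Reasoning
    length-++ : ∀ (xs ys : List (List ℕ)) → + length (xs ++ ys) ≡ + length xs +ᶻ + length ys
    length-++ xs ys = trans (cong +_ (List.length-++ xs)) (ℤ.pos-+ (length xs) (length ys))
    interchange : ∀ a b c d → (a +ᶻ b) - (c +ᶻ d) ≡ (a - c) +ᶻ (b - d)
    interchange = solve-∀

  parity-difference : ∀ n →
    + length (partitionList 0 n) - + length (partitionList 1 n) ≡ + length (distinctOddList n)
  parity-difference n = concatMap-length-difference
    (partitionBlock 0 n) (partitionBlock 1 n) (distinctOddBlock n) (block-difference n) (range 0 (suc n))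

open Lists using (enumerations-length)
open Counting
open import Relation.Binary.PropositionalEquality using (cong; cong₂; module ≡-Reasoning)

corollary1p6 : (n : ℕ) (Ev Od D : List (List ℕ))
    → Enumerates (λ p → IsPartition n p × SumEven p) Ev
    → Enumerates (λ p → IsPartition n p × SumOdd p) Od
    → Enumerates (IsDistinctOddPartition n) D
    → (+ length Ev) - (+ length Od) ≡ + length D
corollary1p6 n Ev Od D Ev-enum Od-enum D-enum = begin
  + length Ev - + length Od
    ≡⟨ cong₂ (λ a b → + a - + b) (enumerations-length Ev-enum (partitionList-enumerates 0 n))
                                 (enumerations-length Od-enum (partitionList-enumerates 1 n)) ⟩
  + length (partitionList 0 n) - + length (partitionList 1 n)
    ≡⟨ parity-difference n ⟩
  + length (distinctOddList n)
    ≡⟨ cong +_ (enumerations-length D-enum (distinctOddList-enumerates n)) ⟨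
  + length D ∎
  where open ≡-Reasoning
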